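{- (a) Let $3\le r\le n-1$. Then $s_2(n,r)\ge \binom{n-r+2}{2}+r-1$. (b) Let $n\ge 6$ and $\frac{n}{2}+2\le r\le n-1$. Then $s_2(n,r)\ge \binom{n-r+3}{2}+r-3$.
   Context: All graphs are finite, simple and undirected. An $r$-colouring of a graph $G$ is a function $c:E(G)\to\{1,\dots,r\}$ (not necessarily proper). A path is rainbow if all its edges have distinct colours. For a $2$-connected graph $G$, a colouring is rainbow $2$-connected if every two vertices of $G$ are connected by two internally vertex-disjoint rainbow paths, and the rainbow $2$-connection number $rc_2(G)$ is the minimum number of colours in a rainbow $2$-connected colouring of $G$. For integers $n$ and $r\ge 1$, $s_2(n,r)$ denotes the maximum number of edges in a $2$-connected graph $G$ on $n$ vertices with $rc_2(G)\ge r$. -}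

module Defs where

open import Data.Nat using (ℕ; zero; suc; _+_; _≤_; _<ᵇ_)
open import Data.Bool using (Bool; true; false; T; _∧_; if_then_else_)
open import Data.Fin using (Fin; toℕ)
open import Data.List using (List; []; _∷_; map)
open import Data.Nat.ListAction using (sum)
open import Data.List.Base using (allFin)
open import Data.List.Membership.Propositional using (_∈_)
open import Data.List.Relation.Unary.Unique.Propositional using (Unique)
open import Data.Product using (Σ; _×_; ∃)
open import Data.Sum using (_⊎_)
open import Relation.Binary.PropositionalEquality using (_≡_; _≢_)

record Graph (n : ℕ) : Set where
  field
    adj   : Fin n → Fin n → Bool
    sym   : ∀ i j → adj i j ≡ adj j i
    irrefl : ∀ i → adj i i ≡ false
open Graph public

module _ {n : ℕ} (G : Graph n) where

  edgeCount : ℕ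
  edgeCount = sum (map (λ i → sum (map (λ j →
      if (toℕ i <ᵇ toℕ j) ∧ adj G i j then 1 else 0) (allFin n))) (allFin n))

  data Walk : Fin n → Fin n → Set where
    [_]   : (u : Fin n) → Walk u u
    _∷⟨_⟩_ : (u : Fin n) {v w : Fin n} → T (adj G u v) → Walk v w → Walk u w

  vertices : ∀ {u w} → Walk u w → List (Fin n)
  vertices [ u ] = u ∷ []
  vertices (u ∷⟨ _ ⟩ p) = u ∷ vertices p

  IsPath : ∀ {u w} → Walk u w → Set
  IsPath p = Unique (vertices p)

  Connected : Set
  Connected = ∀ (u w : Fin n) → Σ (Walk u w) IsPath

  TwoConnected : Set
  TwoConnected = (3 ≤ n) × Connected ×
    (∀ (v u w : Fin n) → u ≢ v → w ≢ v →
       Σ (Walk u w) λ p → IsPath p × ¬∈ v p)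
    where
    ¬∈ : ∀ {a b} → Fin n → Walk a b → Set
    ¬∈ v p = v ∈ vertices p → Data.Empty.⊥
      where import Data.Empty

  record Colouring (k : ℕ) : Set where
    field
      col    : (i j : Fin n) → T (adj G i j) → Fin k
      colSym : ∀ i j (e : T (adj G i j)) (e' : T (adj G j i)) → col i j e ≡ col j i e'
  open Colouring public

  colours : ∀ {k} → Colouring k → ∀ {u w} → Walk u w → List (Fin k)
  colours c [ u ] = []
  colours c (u ∷⟨ e ⟩ p) = col c u _ e ∷ colours c p

  RainbowPath : ∀ {k} → Colouring k → ∀ {u w} → Walk u w → Set
  RainbowPath c p = IsPath p × Unique (colours c p)

  Rainbow2Connected : ∀ {k} → Colouring k → Set
  Rainbow2Connected c = ∀ (u w : Fin n) → u ≢ w →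
    Σ (Walk u w) λ p → Σ (Walk u w) λ q →
      RainbowPath c p × RainbowPath c q × vertices p ≢ vertices q ×
      (∀ x → x ∈ vertices p → x ∈ vertices q → (x ≡ u) ⊎ (x ≡ w))

  rc₂≥ : ℕ → Set
  rc₂≥ r = ∀ k → suc k ≤ r → (c : Colouring k) → Rainbow2Connected c → Data.Empty.⊥
    where import Data.Empty

s₂≥ : ℕ → ℕ → ℕ → Set
s₂≥ n r m = Σ (Graph n) λ G → TwoConnected G × rc₂≥ G r × (m ≤ edgeCount G)

-- Both bounds are witnessed by graphs on {0, ..., n-1} made of the path 0 - 1 - ... - (n-1), a clique
-- on {t, ..., n-1} and the edges from 0 to {q, ..., n-1}.  They contain the Hamiltonian cycle
-- 0, 1, ..., n-1, 0, hence are 2-connected, and they have the required number of edges.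
--
-- In a rainbow 2-connected colouring, for each i < t one of the two rainbow paths joining i and i+1
-- avoids the edge {i, i+1}.  As 1, ..., t-1 have degree two, it uses all other edges {j, j+1} with
-- j < t, an edge {0, d} with q ≤ d, and an edge {t, d'} with t < d' (or the edge {0, t}).
-- If q = t and there are at most t colours, this forces the edge {0, t}; any two of {0, t} and the
-- t path edges then lie on a common such path (for some i < 3), so they need t+1 colours.
-- If q = t+1 and there are at most t+1 colours, it forces d = d'; there are fewer candidates for d
-- than values of i, so two paths share d, and {0, d}, {t, d} and the path edges need t+2 colours.
-- The case t = 2 of (a) is argued separately: with two colours rainbow paths have at most two edges.

module Submission where

open import Defs hiding (sym)
open import Data.Bool using (Bool; true; false; T; T?; _∧_; if_then_else_)
open import Data.Bool.Properties using (T-irrelevant)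
open import Data.Empty using (⊥; ⊥-elim)
open import Data.Fin using (Fin; toℕ; fromℕ<)
import Data.Fin as Fin
open import Data.Fin.Patterns using (0F; 1F)
open import Data.Fin.Properties using (toℕ-injective; toℕ<n; toℕ≤pred[n]; toℕ-fromℕ<; fromℕ<-toℕ; injective⇒≤; pigeonhole)
open import Data.List using (List; []; _∷_; _++_; map; tabulate; allFin)
import Data.List.Properties as List
open import Data.List.Properties using (map-tabulate)
open import Data.List.Membership.Propositional using (_∈_; _∉_)
open import Data.List.Membership.Propositional.Properties using (∈-++⁻; ∈-map⁺; ∈-map⁻)
open import Data.List.Relation.Unary.All as All using (All; []; _∷_)
open import Data.List.Relation.Unary.AllPairs as AllPairs using (AllPairs; []; _∷_)
open import Data.List.Relation.Unary.Any using (here; there)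
open import Data.List.Relation.Unary.Unique.Propositional using (Unique)
import Data.List.Relation.Unary.Unique.Propositional.Properties as Unique
open import Data.Nat using (ℕ; zero; suc; _+_; _*_; _∸_; _≤_; _<_; _<ᵇ_; z≤n; s≤s; s≤s⁻¹; _≟_; _<?_; _≤?_)
open import Data.Nat.Combinatorics using (_C_; nC1≡n; nCk+nC[k+1]≡[n+1]C[k+1])
open import Data.Nat.ListAction using (sum)
open import Data.Nat.Properties
open import Data.Nat.Solver using (module +-*-Solver)
open import Data.Product using (Σ; _×_; _,_; proj₁; proj₂)
import Data.Product as Product
open import Data.Sum using (_⊎_; inj₁; inj₂)
open import Data.Unit using (tt)
open import Function using (_∘_)
open import Relation.Binary.Definitions using (tri<; tri≈; tri>)
open import Relation.Binary.PropositionalEquality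
open import Relation.Nullary using (¬_; Dec; yes; no)
open import Relation.Nullary.Decidable using (_×-dec_; _⊎-dec_; isYes)
open import Algebra.Properties.CommutativeSemigroup +-commutativeSemigroup using (interchange; x∙yz≈y∙xz)

∑< : ℕ → (ℕ → ℕ) → ℕ
∑< zero    f = 0
∑< (suc n) f = f 0 + ∑< n (λ a → f (suc a))

syntax ∑< n (λ a → e) = ∑[ a < n ] e

𝟙 : {P : Set} → Dec P → ℕ
𝟙 (yes _) = 1
𝟙 (no _)  = 0

𝟙-cong : {P Q : Set} (p? : Dec P) (q? : Dec Q) → (P → Q) → (Q → P) → 𝟙 p? ≡ 𝟙 q?
𝟙-cong (yes _) (yes _)  _ _ = refl
𝟙-cong (no _)  (no _)   _ _ = refl
𝟙-cong (yes p) (no ¬q)  f _ = ⊥-elim (¬q (f p))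
𝟙-cong (no ¬p) (yes q)  _ g = ⊥-elim (¬p (g q))

𝟙-yes : {P : Set} (p? : Dec P) → P → 𝟙 p? ≡ 1
𝟙-yes (yes _) _ = refl
𝟙-yes (no ¬p) p = ⊥-elim (¬p p)

𝟙-no : {P : Set} (p? : Dec P) → ¬ P → 𝟙 p? ≡ 0
𝟙-no (yes p) ¬p = ⊥-elim (¬p p)
𝟙-no (no _)  _  = refl

𝟙-× : {P Q : Set} (p? : Dec P) (q? : Dec Q) → 𝟙 (p? ×-dec q?) ≡ 𝟙 p? * 𝟙 q?
𝟙-× (yes _) (yes _) = refl
𝟙-× (yes _) (no _)  = refl
𝟙-× (no _)  (yes _) = refl
𝟙-× (no _)  (no _)  = refl

∑<-cong : ∀ n {f g} → (∀ a → f a ≡ g a) → ∑< n f ≡ ∑< n g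
∑<-cong zero    f≡g = refl
∑<-cong (suc n) f≡g = cong₂ _+_ (f≡g 0) (∑<-cong n (λ a → f≡g (suc a)))

∑<-mono-≤ : ∀ n {f g} → (∀ a → f a ≤ g a) → ∑< n f ≤ ∑< n g
∑<-mono-≤ zero    f≤g = z≤n
∑<-mono-≤ (suc n) f≤g = +-mono-≤ (f≤g 0) (∑<-mono-≤ n (λ a → f≤g (suc a)))

∑<-distrib-+ : ∀ n f g → ∑[ a < n ] (f a + g a) ≡ ∑< n f + ∑< n g
∑<-distrib-+ zero    f g = refl
∑<-distrib-+ (suc n) f g = begin
  f 0 + g 0 + ∑[ a < n ] (f (suc a) + g (suc a))            ≡⟨ cong (f 0 + g 0 +_) (∑<-distrib-+ n _ _) ⟩
  f 0 + g 0 + (∑[ a < n ] f (suc a) + ∑[ a < n ] g (suc a)) ≡⟨ interchange (f 0) (g 0) _ _ ⟩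
  f 0 + ∑[ a < n ] f (suc a) + (g 0 + ∑[ a < n ] g (suc a)) ∎
  where open ≡-Reasoning

∑<-distribˡ-* : ∀ n c f → ∑[ a < n ] (c * f a) ≡ c * ∑< n f
∑<-distribˡ-* zero    c f = sym (*-zeroʳ c)
∑<-distribˡ-* (suc n) c f =
  trans (cong (c * f 0 +_) (∑<-distribˡ-* n c _)) (sym (*-distribˡ-+ c (f 0) _))

∑<-zero : ∀ n {f} → (∀ a → f a ≡ 0) → ∑< n f ≡ 0
∑<-zero zero    f≡0 = refl
∑<-zero (suc n) f≡0 = cong₂ _+_ (f≡0 0) (∑<-zero n (λ a → f≡0 (suc a)))

count-≡ : ∀ c n → ∑[ b < n ] 𝟙 (b ≟ c) ≡ 𝟙 (c <? n)
count-≡ c       zero    = sym (𝟙-no (c <? 0) (λ ()))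
count-≡ zero    (suc n) = cong suc (∑<-zero n (λ a → 𝟙-no (suc a ≟ 0) (λ ())))
count-≡ (suc c) (suc n) = begin
  𝟙 (0 ≟ suc c) + ∑[ a < n ] 𝟙 (suc a ≟ suc c) ≡⟨ cong (_+ ∑[ a < n ] 𝟙 (suc a ≟ suc c)) (𝟙-no (0 ≟ suc c) (λ ())) ⟩
  ∑[ a < n ] 𝟙 (suc a ≟ suc c)                 ≡⟨ ∑<-cong n (λ a → 𝟙-cong (suc a ≟ suc c) (a ≟ c) suc-injective (cong suc)) ⟩
  ∑[ a < n ] 𝟙 (a ≟ c)                         ≡⟨ count-≡ c n ⟩
  𝟙 (c <? n)                                   ≡⟨ 𝟙-cong (c <? n) (suc c <? suc n) s≤s s≤s⁻¹ ⟩
  𝟙 (suc c <? suc n)                           ∎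
  where open ≡-Reasoning

count-≥ : ∀ c n → ∑[ b < n ] 𝟙 (c ≤? b) ≡ n ∸ c
count-≥ c       zero    = sym (0∸n≡0 c)
count-≥ zero    (suc n) =
  cong suc (trans (∑<-cong n (λ a → 𝟙-cong (0 ≤? suc a) (0 ≤? a) (λ _ → z≤n) (λ _ → z≤n))) (count-≥ 0 n))
count-≥ (suc c) (suc n) = begin
  𝟙 (suc c ≤? 0) + ∑[ a < n ] 𝟙 (suc c ≤? suc a) ≡⟨ cong (_+ ∑[ a < n ] 𝟙 (suc c ≤? suc a)) (𝟙-no (suc c ≤? 0) (λ ())) ⟩
  ∑[ a < n ] 𝟙 (suc c ≤? suc a)                  ≡⟨ ∑<-cong n (λ a → 𝟙-cong (suc c ≤? suc a) (c ≤? a) s≤s⁻¹ s≤s) ⟩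
  ∑[ a < n ] 𝟙 (c ≤? a)                          ≡⟨ count-≥ c n ⟩
  n ∸ c                                          ∎
  where open ≡-Reasoning

count-< : ∀ m n → m ≤ n → ∑[ a < n ] 𝟙 (a <? m) ≡ m
count-< zero    n       _         = ∑<-zero n (λ a → 𝟙-no (a <? 0) (λ ()))
count-< (suc m) (suc n) (s≤s m≤n) =
  cong suc (trans (∑<-cong n (λ a → 𝟙-cong (suc a <? suc m) (a <? m) s≤s⁻¹ s≤s)) (count-< m n m≤n))

∑<-from : ∀ t n f → ∑[ a < n ] (𝟙 (t ≤? a) * f a) ≡ ∑[ a < n ∸ t ] f (t + a)
∑<-from zero    n       f = ∑<-cong n (λ a → trans (cong (_* f a) (𝟙-yes (0 ≤? a) z≤n)) (+-identityʳ (f a)))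
∑<-from (suc t) zero    f = refl
∑<-from (suc t) (suc n) f = begin
  𝟙 (suc t ≤? 0) * f 0 + ∑[ a < n ] (𝟙 (suc t ≤? suc a) * f (suc a))
    ≡⟨ cong (λ z → z * f 0 + ∑[ a < n ] (𝟙 (suc t ≤? suc a) * f (suc a))) (𝟙-no (suc t ≤? 0) (λ ())) ⟩
  ∑[ a < n ] (𝟙 (suc t ≤? suc a) * f (suc a))
    ≡⟨ ∑<-cong n (λ a → cong (_* f (suc a)) (𝟙-cong (suc t ≤? suc a) (t ≤? a) s≤s⁻¹ s≤s)) ⟩
  ∑[ a < n ] (𝟙 (t ≤? a) * f (suc a))
    ≡⟨ ∑<-from t n (λ a → f (suc a)) ⟩
  ∑[ a < n ∸ t ] f (suc (t + a)) ∎
  where open ≡-Reasoning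

∑<-triangle : ∀ N → ∑[ a < N ] (N ∸ (2 + a)) ≡ (N ∸ 1) C 2
∑<-triangle zero    = refl
∑<-triangle (suc N) = trans (cong ((N ∸ 1) +_) (∑<-triangle N)) (pascal N)
  where
  pascal : ∀ N → (N ∸ 1) + (N ∸ 1) C 2 ≡ N C 2
  pascal zero    = refl
  pascal (suc N) = trans (cong (_+ N C 2) (sym (nC1≡n N))) (nCk+nC[k+1]≡[n+1]C[k+1] N 1)

∑²-distrib-+ : ∀ m n (f g : ℕ → ℕ → ℕ) →
  ∑[ a < m ] ∑[ b < n ] (f a b + g a b) ≡ ∑[ a < m ] ∑[ b < n ] f a b + ∑[ a < m ] ∑[ b < n ] g a b
∑²-distrib-+ m n f g =
  trans (∑<-cong m (λ a → ∑<-distrib-+ n (f a) (g a))) (∑<-distrib-+ m (λ a → ∑< n (f a)) (λ a → ∑< n (g a)))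

count-successor-pairs : ∀ n → ∑[ a < n ] ∑[ b < n ] 𝟙 (b ≟ suc a) ≡ n ∸ 1
count-successor-pairs n = begin
  ∑[ a < n ] ∑[ b < n ] 𝟙 (b ≟ suc a) ≡⟨ ∑<-cong n (λ a → count-≡ (suc a) n) ⟩
  ∑[ a < n ] 𝟙 (suc a <? n)          ≡⟨ ∑<-cong n (λ a → 𝟙-cong (suc a <? n) (a <? n ∸ 1) (shift n) (unshift n)) ⟩
  ∑[ a < n ] 𝟙 (a <? n ∸ 1)          ≡⟨ count-< (n ∸ 1) n (m∸n≤m n 1) ⟩
  n ∸ 1                              ∎
  where
  open ≡-Reasoning
  shift : ∀ n {a} → suc a < n → a < n ∸ 1
  shift (suc n) = s≤s⁻¹
  unshift : ∀ n {a} → a < n ∸ 1 → suc a < n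
  unshift (suc n) = s≤s

count-gapped-pairs : ∀ t n → ∑[ a < n ] ∑[ b < n ] 𝟙 ((t ≤? a) ×-dec (2 + a ≤? b)) ≡ (n ∸ t ∸ 1) C 2
count-gapped-pairs t n = begin
  ∑[ a < n ] ∑[ b < n ] 𝟙 ((t ≤? a) ×-dec (2 + a ≤? b))
    ≡⟨ ∑<-cong n (λ a → trans (∑<-cong n (λ b → 𝟙-× (t ≤? a) (2 + a ≤? b))) (∑<-distribˡ-* n (𝟙 (t ≤? a)) (λ b → 𝟙 (2 + a ≤? b)))) ⟩
  ∑[ a < n ] (𝟙 (t ≤? a) * ∑[ b < n ] 𝟙 (2 + a ≤? b))
    ≡⟨ ∑<-cong n (λ a → cong (𝟙 (t ≤? a) *_) (count-≥ (2 + a) n)) ⟩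
  ∑[ a < n ] (𝟙 (t ≤? a) * (n ∸ (2 + a)))
    ≡⟨ ∑<-from t n (λ a → n ∸ (2 + a)) ⟩
  ∑[ a < n ∸ t ] (n ∸ (2 + (t + a)))
    ≡⟨ ∑<-cong (n ∸ t) (λ a → trans (cong (n ∸_) (x∙yz≈y∙xz 2 t a)) (sym (∸-+-assoc n t (2 + a)))) ⟩
  ∑[ a < n ∸ t ] (n ∸ t ∸ (2 + a))
    ≡⟨ ∑<-triangle (n ∸ t) ⟩
  (n ∸ t ∸ 1) C 2 ∎
  where open ≡-Reasoning

count-row-zero : ∀ n q → 1 ≤ n → ∑[ a < n ] ∑[ b < n ] 𝟙 ((a ≟ 0) ×-dec (q ≤? b)) ≡ n ∸ q
count-row-zero (suc m) q _ = begin
  ∑[ b < suc m ] 𝟙 ((0 ≟ 0) ×-dec (q ≤? b)) + ∑[ a < m ] ∑[ b < suc m ] 𝟙 ((suc a ≟ 0) ×-dec (q ≤? b))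
    ≡⟨ cong₂ _+_ (∑<-cong (suc m) (λ b → 𝟙-cong ((0 ≟ 0) ×-dec (q ≤? b)) (q ≤? b) proj₂ (refl ,_)))
                 (∑<-zero m (λ a → ∑<-zero (suc m) (λ b → 𝟙-no ((suc a ≟ 0) ×-dec (q ≤? b)) (λ ())))) ⟩
  ∑[ b < suc m ] 𝟙 (q ≤? b) + 0
    ≡⟨ +-identityʳ _ ⟩
  ∑[ b < suc m ] 𝟙 (q ≤? b)
    ≡⟨ count-≥ q (suc m) ⟩
  suc m ∸ q ∎
  where open ≡-Reasoning

avoid-two : ∀ j j′ → Σ ℕ λ i → i < 3 × i ≢ j × i ≢ j′
avoid-two j j′ with 0 ≟ j | 0 ≟ j′
... | no 0≢j | no 0≢j′ = 0 , s≤s z≤n , 0≢j , 0≢j′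
avoid-two j j′ | yes refl | _ with 1 ≟ j′
... | no 1≢j′  = 1 , s≤s (s≤s z≤n) , (λ ()) , 1≢j′
... | yes refl = 2 , ≤-refl , (λ ()) , (λ ())
avoid-two j j′ | no _ | yes refl with 1 ≟ j
... | no 1≢j   = 1 , s≤s (s≤s z≤n) , 1≢j , (λ ())
... | yes refl = 2 , ≤-refl , (λ ()) , (λ ())

punchIn : ℕ → ℕ → ℕ
punchIn i m with m <? i
... | yes _ = m
... | no _  = suc m

punchInᵢ≢i : ∀ i m → punchIn i m ≢ i
punchInᵢ≢i i m with m <? i
... | yes m<i = λ m≡i → <-irrefl m≡i m<i
... | no m≮i  = λ 1+m≡i → m≮i (subst (m <_) 1+m≡i ≤-refl)

punchIn-< : ∀ i {a} m → m < a → punchIn i m < suc a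
punchIn-< i m m<a with m <? i
... | yes _ = <-trans m<a (n<1+n _)
... | no _  = s≤s m<a

punchIn-injective : ∀ i m m′ → punchIn i m ≡ punchIn i m′ → m ≡ m′
punchIn-injective i m m′ eq with m <? i | m′ <? i
... | yes _   | yes _    = eq
... | no _    | no _     = suc-injective eq
... | yes m<i | no m′≮i  = ⊥-elim (<-irrefl eq (<-≤-trans m<i (≤-trans (≮⇒≥ m′≮i) (n≤1+n m′))))
... | no m≮i  | yes m′<i = ⊥-elim (<-irrefl (sym eq) (<-≤-trans m′<i (≤-trans (≮⇒≥ m≮i) (n≤1+n m))))

unique-map⇒injective : ∀ {A B : Set} (f : A → B) {xs : List A} {a b : A} →
                       Unique (map f xs) → a ∈ xs → b ∈ xs → f a ≡ f b → a ≡ b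
unique-map⇒injective f (_ ∷ _)  (here refl) (here refl) _  = refl
unique-map⇒injective f (a∉ ∷ _) (here refl) (there b∈) fa≡fb = ⊥-elim (All.lookup a∉ (∈-map⁺ f b∈) fa≡fb)
unique-map⇒injective f (b∉ ∷ _) (there a∈) (here refl) fa≡fb = ⊥-elim (All.lookup b∉ (∈-map⁺ f a∈) (sym fa≡fb))
unique-map⇒injective f (_ ∷ u)  (there a∈) (there b∈) fa≡fb = unique-map⇒injective f u a∈ b∈ fa≡fb

injectiveBelow⇒≤ : ∀ {k} (f : ℕ → Fin k) a → (∀ m m′ → m < a → m′ < a → f m ≡ f m′ → m ≡ m′) → a ≤ k
injectiveBelow⇒≤ f a inj =
  injective⇒≤ {f = λ i → f (toℕ i)} (λ {i} {j} eq → toℕ-injective (inj (toℕ i) (toℕ j) (toℕ<n i) (toℕ<n j) eq))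

pigeonhole-range : ∀ {m lo hi} (f : Fin m → ℕ) → (∀ a → lo ≤ f a × f a < hi) → hi ∸ lo < m →
                   Σ (Fin m) λ a → Σ (Fin m) λ b → a ≢ b × f a ≡ f b
pigeonhole-range {lo = lo} {hi} f bounds small =
  let a , b , a<b , same = pigeonhole small (λ a → fromℕ< (offset< a))
  in a , b , (λ a≡b → <-irrefl (cong toℕ a≡b) a<b) , (begin
     f a            ≡⟨ sym (m∸n+n≡m (proj₁ (bounds a))) ⟩
     f a ∸ lo + lo  ≡⟨ cong (_+ lo) (trans (sym (toℕ-fromℕ< (offset< a))) (trans (cong toℕ same) (toℕ-fromℕ< (offset< b)))) ⟩
     f b ∸ lo + lo  ≡⟨ m∸n+n≡m (proj₁ (bounds b)) ⟩
     f b            ∎)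
  where
  open ≡-Reasoning
  offset< : ∀ a → f a ∸ lo < hi ∸ lo
  offset< a = ∸-monoˡ-< (proj₂ (bounds a)) (proj₁ (bounds a))

two-valued : ∀ {k} → k ≤ 2 → (a b c : Fin k) → a ≢ c → b ≢ c → a ≡ b
two-valued (s≤s z≤n)       0F 0F _  _   _   = refl
two-valued (s≤s (s≤s z≤n)) 0F 0F _  _   _   = refl
two-valued (s≤s (s≤s z≤n)) 1F 1F _  _   _   = refl
two-valued (s≤s (s≤s z≤n)) 0F 1F 0F 0≢0 _   = ⊥-elim (0≢0 refl)
two-valued (s≤s (s≤s z≤n)) 0F 1F 1F _   1≢1 = ⊥-elim (1≢1 refl)
two-valued (s≤s (s≤s z≤n)) 1F 0F 0F _   0≢0 = ⊥-elim (0≢0 refl)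
two-valued (s≤s (s≤s z≤n)) 1F 0F 1F 1≢1 _   = ⊥-elim (1≢1 refl)

sum-tabulate : ∀ n (g : Fin n → ℕ) (h : ℕ → ℕ) → (∀ i → g i ≡ h (toℕ i)) → sum (tabulate g) ≡ ∑< n h
sum-tabulate zero    g h g≡h = refl
sum-tabulate (suc n) g h g≡h =
  cong₂ _+_ (g≡h Fin.zero) (sum-tabulate n (λ i → g (Fin.suc i)) (λ a → h (suc a)) (λ i → g≡h (Fin.suc i)))

sum-allFin : ∀ n (g : Fin n → ℕ) (h : ℕ → ℕ) → (∀ i → g i ≡ h (toℕ i)) → sum (map g (allFin n)) ≡ ∑< n h
sum-allFin n g h g≡h = trans (cong sum (map-tabulate (λ i → i) g)) (sum-tabulate n g h g≡h)

edgeCount-labelled : ∀ {n} (G : Graph n) (A : ℕ → ℕ → Bool) → (∀ i j → adj G i j ≡ A (toℕ i) (toℕ j)) →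
  edgeCount G ≡ ∑[ a < n ] ∑[ b < n ] (if (a <ᵇ b) ∧ A a b then 1 else 0)
edgeCount-labelled {n} G A adj≡A =
  sum-allFin n _ _ (λ i → sum-allFin n _ _ (λ j → cong (λ e → if (toℕ i <ᵇ toℕ j) ∧ e then 1 else 0) (adj≡A i j)))

adj-sym : ∀ {n} (G : Graph n) {x y} → T (adj G x y) → T (adj G y x)
adj-sym G {x} {y} = subst T (Graph.sym G x y)

module _ {n : ℕ} {G : Graph n} where

  _▹⟨_⟩_ : ∀ {u v z w} → Walk G u v → T (adj G v z) → Walk G z w → Walk G u w
  [ u ]         ▹⟨ e ⟩ q = u ∷⟨ e ⟩ q
  (u ∷⟨ e′ ⟩ p) ▹⟨ e ⟩ q = u ∷⟨ e′ ⟩ (p ▹⟨ e ⟩ q)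

  vertices-▹ : ∀ {u v z w} (p : Walk G u v) (e : T (adj G v z)) (q : Walk G z w) →
               vertices G (p ▹⟨ e ⟩ q) ≡ vertices G p ++ vertices G q
  vertices-▹ [ u ]         e q = refl
  vertices-▹ (u ∷⟨ e′ ⟩ p) e q = cong (u ∷_) (vertices-▹ p e q)

module HamiltonianCycle {n : ℕ} (G : Graph n)
  (consecutive : ∀ (x y : Fin n) → toℕ y ≡ suc (toℕ x) → T (adj G x y))
  (first-last  : ∀ (x y : Fin n) → toℕ x ≡ 0 → suc (toℕ y) ≡ n → T (adj G x y)) where

  Ascending Descending : List (Fin n) → Set
  Ascending  = AllPairs (λ a b → toℕ a < toℕ b)
  Descending = AllPairs (λ a b → toℕ b < toℕ a)

  Within : ℕ → ℕ → List (Fin n) → Set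
  Within lo hi = All (λ v → lo ≤ toℕ v × toℕ v ≤ hi)

  ascending⇒unique : ∀ {xs} → Ascending xs → Unique xs
  ascending⇒unique = AllPairs.map (λ lt eq → <-irrefl (cong toℕ eq) lt)

  descending⇒unique : ∀ {xs} → Descending xs → Unique xs
  descending⇒unique = AllPairs.map (λ lt eq → <-irrefl (cong toℕ (sym eq)) lt)

  outside⇒∉ : ∀ {lo hi xs} → Within lo hi xs → ∀ v → toℕ v < lo ⊎ hi < toℕ v → v ∉ xs
  outside⇒∉ w v (inj₁ v<lo) v∈ = <⇒≱ v<lo (proj₁ (All.lookup w v∈))
  outside⇒∉ w v (inj₂ hi<v) v∈ = <⇒≱ hi<v (proj₂ (All.lookup w v∈))

  separated⇒disjoint : ∀ {lo₁ hi₁ lo₂ hi₂ xs ys} → Within lo₁ hi₁ xs → Within lo₂ hi₂ ys → hi₁ < lo₂ →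
                       ∀ {v} → ¬ (v ∈ xs × v ∈ ys)
  separated⇒disjoint w₁ w₂ hi₁<lo₂ (v∈xs , v∈ys) =
    <⇒≱ (≤-<-trans (proj₂ (All.lookup w₁ v∈xs)) hi₁<lo₂) (proj₁ (All.lookup w₂ v∈ys))

  ∉-++ : ∀ {xs ys} {v : Fin n} → v ∉ xs → v ∉ ys → v ∉ xs ++ ys
  ∉-++ {xs} v∉xs v∉ys v∈ with ∈-++⁻ xs v∈
  ... | inj₁ v∈xs = v∉xs v∈xs
  ... | inj₂ v∈ys = v∉ys v∈ys

  ascendingPath : ∀ d (x y : Fin n) → toℕ x + d ≡ toℕ y →
    Σ (Walk G x y) λ p → Within (toℕ x) (toℕ y) (vertices G p) × Ascending (vertices G p)
  ascendingPath zero x y eq with toℕ-injective {i = x} {j = y} (trans (sym (+-identityʳ _)) eq)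
  ... | refl = [ x ] , (≤-refl , ≤-refl) ∷ [] , [] ∷ []
  ascendingPath (suc d) x y eq =
    let p , within , ascending = ascendingPath d x′ y (trans (cong (_+ d) x′≡) (trans (sym (+-suc (toℕ x) d)) eq))
    in x ∷⟨ consecutive x x′ x′≡ ⟩ p
       , (≤-refl , <⇒≤ x<y) ∷ All.map (λ (lo , hi) → ≤-trans (n≤1+n _) (subst (_≤ _) x′≡ lo) , hi) within
       , All.map (λ (lo , _) → subst (_≤ _) x′≡ lo) within ∷ ascending
    where
    x<y : toℕ x < toℕ y
    x<y = subst (toℕ x <_) eq (m<m+n (toℕ x) (s≤s z≤n))
    x′ : Fin n
    x′ = fromℕ< (≤-<-trans x<y (toℕ<n y))
    x′≡ : toℕ x′ ≡ suc (toℕ x)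
    x′≡ = toℕ-fromℕ< (≤-<-trans x<y (toℕ<n y))

  descendingPath : ∀ d (x y : Fin n) → toℕ y + d ≡ toℕ x →
    Σ (Walk G x y) λ p → Within (toℕ y) (toℕ x) (vertices G p) × Descending (vertices G p)
  descendingPath zero x y eq with toℕ-injective {i = y} {j = x} (trans (sym (+-identityʳ _)) eq)
  ... | refl = [ x ] , (≤-refl , ≤-refl) ∷ [] , [] ∷ []
  descendingPath (suc d) x y eq =
    let p , within , descending = descendingPath d x′ y (sym x′≡)
    in x ∷⟨ adj-sym G (consecutive x′ x x≡) ⟩ p
       , (<⇒≤ y<x , ≤-refl) ∷ All.map (λ (lo , hi) → lo , ≤-trans hi (subst (toℕ x′ ≤_) (sym x≡) (n≤1+n _))) within
       , All.map (λ (_ , hi) → subst (_ ≤_) (sym x≡) (s≤s hi)) within ∷ descending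
    where
    y<x : toℕ y < toℕ x
    y<x = subst (toℕ y <_) eq (m<m+n (toℕ y) (s≤s z≤n))
    x′<n : toℕ y + d < n
    x′<n = <-trans (subst (toℕ y + d <_) eq (+-monoʳ-< (toℕ y) (n<1+n d))) (toℕ<n x)
    x′ : Fin n
    x′ = fromℕ< x′<n
    x′≡ : toℕ x′ ≡ toℕ y + d
    x′≡ = toℕ-fromℕ< x′<n
    x≡ : toℕ x ≡ suc (toℕ x′)
    x≡ = trans (sym eq) (trans (+-suc (toℕ y) d) (cong suc (sym x′≡)))

  module _ (3≤n : 3 ≤ n) where

    0<n : 0 < n
    0<n = ≤-trans (s≤s z≤n) 3≤n

    n∸1<n : n ∸ 1 < n
    n∸1<n = ∸-monoʳ-< {o = 0} (s≤s z≤n) 0<n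

    first last : Fin n
    first = fromℕ< 0<n
    last  = fromℕ< n∸1<n

    first≡ : toℕ first ≡ 0
    first≡ = toℕ-fromℕ< 0<n

    last≡ : toℕ last ≡ n ∸ 1
    last≡ = toℕ-fromℕ< n∸1<n

    closing-edge : T (adj G first last)
    closing-edge = first-last first last first≡ (trans (cong suc last≡) (m+[n∸m]≡n 0<n))

    ≤last : ∀ (v : Fin n) → toℕ v ≤ toℕ last
    ≤last v = subst (toℕ v ≤_) (sym last≡) (toℕ≤pred[n] v)

    ≢⇒toℕ≢ : ∀ {a b : Fin n} → a ≢ b → toℕ a ≢ toℕ b
    ≢⇒toℕ≢ a≢b eq = a≢b (toℕ-injective eq)

    PathAvoiding : Fin n → Fin n → Fin n → Set
    PathAvoiding v u w = Σ (Walk G u w) λ p → IsPath G p × v ∉ vertices G p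

    straight-up : ∀ {v u w} → toℕ u ≤ toℕ w → toℕ v < toℕ u ⊎ toℕ w < toℕ v → PathAvoiding v u w
    straight-up {v} {u} {w} u≤w outside =
      let p , within , ascending = ascendingPath (toℕ w ∸ toℕ u) u w (m+[n∸m]≡n u≤w)
      in p , ascending⇒unique ascending , outside⇒∉ within v outside

    straight-down : ∀ {v u w} → toℕ w ≤ toℕ u → toℕ v < toℕ w ⊎ toℕ u < toℕ v → PathAvoiding v u w
    straight-down {v} {u} {w} w≤u outside =
      let p , within , descending = descendingPath (toℕ u ∸ toℕ w) u w (m+[n∸m]≡n w≤u)
      in p , descending⇒unique descending , outside⇒∉ within v outside

    around-down : ∀ {v u w} → toℕ u < toℕ v → toℕ v < toℕ w → PathAvoiding v u w
    around-down {v} {u} {w} u<v v<w =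
      let p , within-p , descending-p = descendingPath (toℕ u) u first (cong (_+ toℕ u) first≡)
          q , within-q , descending-q = descendingPath (toℕ last ∸ toℕ w) last w (m+[n∸m]≡n (≤last w))
          vs = vertices-▹ p closing-edge q
      in p ▹⟨ closing-edge ⟩ q
         , subst Unique (sym vs) (Unique.++⁺ (descending⇒unique descending-p) (descending⇒unique descending-q)
                                             (separated⇒disjoint within-p within-q (<-trans u<v v<w)))
         , subst (v ∉_) (sym vs) (∉-++ (outside⇒∉ within-p v (inj₂ u<v)) (outside⇒∉ within-q v (inj₁ v<w)))

    around-up : ∀ {v u w} → toℕ w < toℕ v → toℕ v < toℕ u → PathAvoiding v u w
    around-up {v} {u} {w} w<v v<u =
      let p , within-p , ascending-p = ascendingPath (toℕ last ∸ toℕ u) u last (m+[n∸m]≡n (≤last u))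
          q , within-q , ascending-q = ascendingPath (toℕ w) first w (cong (_+ toℕ w) first≡)
          vs = vertices-▹ p (adj-sym G closing-edge) q
      in p ▹⟨ adj-sym G closing-edge ⟩ q
         , subst Unique (sym vs) (Unique.++⁺ (ascending⇒unique ascending-p) (ascending⇒unique ascending-q)
                                             (λ (x∈p , x∈q) → separated⇒disjoint within-q within-p (<-trans w<v v<u) (x∈q , x∈p)))
         , subst (v ∉_) (sym vs) (∉-++ (outside⇒∉ within-p v (inj₁ v<u)) (outside⇒∉ within-q v (inj₂ w<v)))

    path-avoiding : ∀ v u w → u ≢ v → w ≢ v → PathAvoiding v u w
    path-avoiding v u w u≢v w≢v with toℕ u ≤? toℕ w
    ... | yes u≤w with toℕ v <? toℕ u | toℕ w <? toℕ v
    ...   | yes v<u | _       = straight-up u≤w (inj₁ v<u)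
    ...   | no _    | yes w<v = straight-up u≤w (inj₂ w<v)
    ...   | no v≮u  | no w≮v  =
      around-down (≤∧≢⇒< (≮⇒≥ v≮u) (≢⇒toℕ≢ u≢v)) (≤∧≢⇒< (≮⇒≥ w≮v) (≢⇒toℕ≢ (w≢v ∘ sym)))
    path-avoiding v u w u≢v w≢v | no u≰w with toℕ v <? toℕ w | toℕ u <? toℕ v
    ...   | yes v<w | _       = straight-down (<⇒≤ (≰⇒> u≰w)) (inj₁ v<w)
    ...   | no _    | yes u<v = straight-down (<⇒≤ (≰⇒> u≰w)) (inj₂ u<v)
    ...   | no v≮w  | no u≮v  =
      around-up (≤∧≢⇒< (≮⇒≥ v≮w) (≢⇒toℕ≢ w≢v)) (≤∧≢⇒< (≮⇒≥ u≮v) (≢⇒toℕ≢ (u≢v ∘ sym)))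

    hamiltonian⇒twoConnected : TwoConnected G
    hamiltonian⇒twoConnected = 3≤n , connected , path-avoiding
      where
      connected : Connected G
      connected u w =
        let i , i<3 , i≢u , i≢w = avoid-two (toℕ u) (toℕ w)
            v = fromℕ< (≤-trans i<3 3≤n)
            v≡i = toℕ-fromℕ< (≤-trans i<3 3≤n)
            p , path , _ = path-avoiding v u w (λ u≡v → i≢u (trans (sym v≡i) (cong toℕ (sym u≡v))))
                                               (λ w≡v → i≢w (trans (sym v≡i) (cong toℕ (sym w≡v))))
        in p , path

Edge : Set
Edge = ℕ × ℕ

SameEdge : Edge → Edge → Set
SameEdge (x , y) (x′ , y′) = (x ≡ x′ × y ≡ y′) ⊎ (x ≡ y′ × y ≡ x′)

SameEdge-sym : ∀ {e e′} → SameEdge e e′ → SameEdge e′ e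
SameEdge-sym (inj₁ (x≡ , y≡)) = inj₁ (sym x≡ , sym y≡)
SameEdge-sym (inj₂ (x≡ , y≡)) = inj₂ (sym y≡ , sym x≡)

infixr 5 _◃_

_◃_ : Edge → (ℕ → Edge) → ℕ → Edge
(e ◃ E) zero    = e
(e ◃ E) (suc m) = E m

-- Edges are compared through the ℕ-labels of their endpoints.  The colour of a pair of labels is
-- taken from c, with the junk colour κ₀ on non-edges and the junk vertex v₀ for labels ≥ n.
module RainbowPaths {n k : ℕ} {G : Graph n} (c : Colouring G k) (v₀ : Fin n) (κ₀ : Fin k) where

  vertexAt : ℕ → Fin n
  vertexAt x with x <? n
  ... | yes x<n = fromℕ< x<n
  ... | no _    = v₀

  vertexAt-toℕ : ∀ u → vertexAt (toℕ u) ≡ u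
  vertexAt-toℕ u with toℕ u <? n
  ... | yes u<n = fromℕ<-toℕ u u<n
  ... | no u≮n  = ⊥-elim (u≮n (toℕ<n u))

  colourAt : Fin n → Fin n → Fin k
  colourAt u v with T? (adj G u v)
  ... | yes e = col c u v e
  ... | no _  = κ₀

  colourAt-edge : ∀ u v (e : T (adj G u v)) → colourAt u v ≡ col c u v e
  colourAt-edge u v e with T? (adj G u v)
  ... | yes e′ = cong (col c u v) (T-irrelevant e′ e)
  ... | no ¬e  = ⊥-elim (¬e e)

  colourAt-sym : ∀ u v → colourAt u v ≡ colourAt v u
  colourAt-sym u v with T? (adj G u v) | T? (adj G v u)
  ... | yes e | yes e′ = colSym c u v e e′
  ... | no _  | no _   = refl
  ... | yes e | no ¬e′ = ⊥-elim (¬e′ (adj-sym G e))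
  ... | no ¬e | yes e′ = ⊥-elim (¬e (adj-sym G e′))

  abstract
    colour : Edge → Fin k
    colour (x , y) = colourAt (vertexAt x) (vertexAt y)

    colour-edge : ∀ u v (e : T (adj G u v)) → colour (toℕ u , toℕ v) ≡ col c u v e
    colour-edge u v e = trans (cong₂ colourAt (vertexAt-toℕ u) (vertexAt-toℕ v)) (colourAt-edge u v e)

    colour-sym : ∀ x y → colour (x , y) ≡ colour (y , x)
    colour-sym x y = colourAt-sym (vertexAt x) (vertexAt y)

  edges : ∀ {u w} → Walk G u w → List (Edge × Fin k)
  edges [ u ]                = []
  edges (_∷⟨_⟩_ u {v} e p) = ((toℕ u , toℕ v) , col c u v e) ∷ edges p

  colours≡ : ∀ {u w} (p : Walk G u w) → colours G c p ≡ map proj₂ (edges p)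
  colours≡ [ u ]        = refl
  colours≡ (u ∷⟨ e ⟩ p) = cong (_ ∷_) (colours≡ p)

  edge-colour : ∀ {u w} (p : Walk G u w) {e κ} → (e , κ) ∈ edges p → κ ≡ colour e
  edge-colour (_∷⟨_⟩_ u {v} e p) (here refl) = sym (colour-edge u v e)
  edge-colour (u ∷⟨ e ⟩ p)       (there e∈)  = edge-colour p e∈

  edge-adjacent : ∀ {u w} (p : Walk G u w) {x y κ} → ((x , y) , κ) ∈ edges p →
                  Σ (Fin n) λ a → Σ (Fin n) λ b → toℕ a ≡ x × toℕ b ≡ y × T (adj G a b)
  edge-adjacent (_∷⟨_⟩_ u {v} e p) (here refl) = u , v , refl , refl , e
  edge-adjacent (u ∷⟨ e ⟩ p)       (there e∈)  = edge-adjacent p e∈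

  Uses : ∀ {u w} → Walk G u w → Edge → Set
  Uses p (x , y) = ((x , y) , colour (x , y)) ∈ edges p ⊎ ((y , x) , colour (y , x)) ∈ edges p

  uses-forward : ∀ {u w} (p : Walk G u w) {x y κ a b} → ((x , y) , κ) ∈ edges p → x ≡ a → y ≡ b → Uses p (a , b)
  uses-forward p {x} {y} e∈ refl refl = inj₁ (subst (λ κ → ((x , y) , κ) ∈ edges p) (edge-colour p e∈) e∈)

  uses-backward : ∀ {u w} (p : Walk G u w) {x y κ a b} → ((x , y) , κ) ∈ edges p → x ≡ a → y ≡ b → Uses p (b , a)
  uses-backward p {x} {y} e∈ refl refl = inj₂ (subst (λ κ → ((x , y) , κ) ∈ edges p) (edge-colour p e∈) e∈)

  Rainbow : ∀ {u w} → Walk G u w → Set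
  Rainbow p = Unique (colours G c p)

  rainbow⇒colour-injective : ∀ {u w} (p : Walk G u w) → Rainbow p → ∀ {e e′} →
    Uses p e → Uses p e′ → colour e ≡ colour e′ → SameEdge e e′
  rainbow⇒colour-injective p rainbow = same
    where
    injective : ∀ {a b : Edge × Fin k} → a ∈ edges p → b ∈ edges p → proj₂ a ≡ proj₂ b → a ≡ b
    injective = unique-map⇒injective proj₂ (subst Unique (colours≡ p) rainbow)
    same : ∀ {e e′} → Uses p e → Uses p e′ → colour e ≡ colour e′ → SameEdge e e′
    same (inj₁ e∈) (inj₁ e′∈) eq with injective e∈ e′∈ eq
    ... | refl = inj₁ (refl , refl)
    same {x , y} (inj₂ e∈) (inj₁ e′∈) eq with injective e∈ e′∈ (trans (colour-sym y x) eq)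
    ... | refl = inj₂ (refl , refl)
    same {e′ = x′ , y′} (inj₁ e∈) (inj₂ e′∈) eq with injective e∈ e′∈ (trans eq (colour-sym x′ y′))
    ... | refl = inj₂ (refl , refl)
    same {x , y} {x′ , y′} (inj₂ e∈) (inj₂ e′∈) eq
      with injective e∈ e′∈ (trans (colour-sym y x) (trans eq (colour-sym x′ y′)))
    ... | refl = inj₁ (refl , refl)

  crossing-edge : ∀ {u w} (p : Walk G u w) (P : ℕ → Set) → (∀ x → Dec (P x)) → ¬ P (toℕ u) → P (toℕ w) →
                  Σ ℕ λ x → Σ ℕ λ y → Σ (Fin k) λ κ → ((x , y) , κ) ∈ edges p × ¬ P x × P y
  crossing-edge [ u ]                P P? ¬Pu Pw = ⊥-elim (¬Pu Pw)
  crossing-edge (_∷⟨_⟩_ u {v} e p) P P? ¬Pu Pw with P? (toℕ v)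
  ... | yes Pv = toℕ u , toℕ v , col c u v e , here refl , ¬Pu , Pv
  ... | no ¬Pv =
    let x , y , κ , e∈ , ¬Px , Py = crossing-edge p P P? ¬Pv Pw in x , y , κ , there e∈ , ¬Px , Py

  first∈ : ∀ {u w} (p : Walk G u w) → u ∈ vertices G p
  first∈ [ u ]        = here refl
  first∈ (u ∷⟨ e ⟩ p) = here refl

  last∈ : ∀ {u w} (p : Walk G u w) → w ∈ vertices G p
  last∈ [ u ]        = here refl
  last∈ (u ∷⟨ e ⟩ p) = there (last∈ p)

  endpoints∈ : ∀ {u w} (p : Walk G u w) {x y κ} → ((x , y) , κ) ∈ edges p →
               x ∈ map toℕ (vertices G p) × y ∈ map toℕ (vertices G p)
  endpoints∈ (u ∷⟨ e ⟩ p) (here refl) = here refl , there (∈-map⁺ toℕ (first∈ p))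
  endpoints∈ (u ∷⟨ e ⟩ p) (there e∈)  = Product.map there there (endpoints∈ p e∈)

  closed-path : ∀ {v} (p : Walk G v v) → IsPath G p → vertices G p ≡ v ∷ []
  closed-path [ v ]        _         = refl
  closed-path (v ∷⟨ e ⟩ p) (v∉ ∷ _) = ⊥-elim (All.lookup v∉ (last∈ p) refl)

  uses-uw⇒single-edge : ∀ {u w} (p : Walk G u w) → IsPath G p → ∀ {x y κ} → ((x , y) , κ) ∈ edges p →
                SameEdge (x , y) (toℕ u , toℕ w) → vertices G p ≡ u ∷ w ∷ []
  uses-uw⇒single-edge (u ∷⟨ e ⟩ p) (_ ∷ path) (here refl) (inj₁ (_ , v≡w)) with toℕ-injective v≡w
  ... | refl = cong (u ∷_) (closed-path p path)
  uses-uw⇒single-edge (u ∷⟨ e ⟩ p) (u∉ ∷ _) (here refl) (inj₂ (u≡w , _)) with toℕ-injective u≡w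
  ... | refl = ⊥-elim (All.lookup u∉ (last∈ p) refl)
  uses-uw⇒single-edge (u ∷⟨ e ⟩ p) (u∉ ∷ _) (there e∈) same = ⊥-elim (u∉vs (endpoint≡u same (endpoints∈ p e∈)))
    where
    endpoint≡u : ∀ {x y} → SameEdge (x , y) (toℕ u , _) → x ∈ map toℕ (vertices G p) × y ∈ map toℕ (vertices G p) →
                 toℕ u ∈ map toℕ (vertices G p)
    endpoint≡u (inj₁ (refl , _)) (x∈ , _) = x∈
    endpoint≡u (inj₂ (_ , refl)) (_ , y∈) = y∈
    u∉vs : toℕ u ∉ map toℕ (vertices G p)
    u∉vs u∈ with ∈-map⁻ toℕ u∈
    ... | z , z∈ , u≡z = All.lookup u∉ z∈ (toℕ-injective u≡z)

  record Detour (u w : Fin n) : Set where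
    field
      path      : Walk G u w
      rainbow   : Rainbow path
      avoids-uw : ∀ {x y κ} → ((x , y) , κ) ∈ edges path → ¬ SameEdge (x , y) (toℕ u , toℕ w)

  -- The two rainbow paths have different vertex lists, so at most one of them is the edge uw.
  abstract
    detour : Rainbow2Connected G c → ∀ u w → u ≢ w → Detour u w
    detour r2c u w u≢w with r2c u w u≢w
    ... | p , q , (path-p , rainbow-p) , (path-q , rainbow-q) , vp≢vq , _
      with List.≡-dec Fin._≟_ (vertices G p) (u ∷ w ∷ [])
    ... | no vp≢uw = record
      { path = p ; rainbow = rainbow-p ; avoids-uw = λ e∈ same → vp≢uw (uses-uw⇒single-edge p path-p e∈ same) }
    ... | yes vp≡uw = record
      { path = q ; rainbow = rainbow-q ; avoids-uw = λ e∈ same → vp≢vq (trans vp≡uw (sym (uses-uw⇒single-edge q path-q e∈ same))) }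

  distinct-colours⇒≤ : ∀ a (E : ℕ → Edge) → (∀ m m′ → m < m′ → m′ < a → colour (E m) ≢ colour (E m′)) → a ≤ k
  distinct-colours⇒≤ a E distinct = injectiveBelow⇒≤ (λ m → colour (E m)) a injective
    where
    injective : ∀ m m′ → m < a → m′ < a → colour (E m) ≡ colour (E m′) → m ≡ m′
    injective m m′ m<a m′<a eq with <-cmp m m′
    ... | tri< m<m′ _ _ = ⊥-elim (distinct m m′ m<m′ m′<a eq)
    ... | tri≈ _ m≡m′ _ = m≡m′
    ... | tri> _ _ m′<m = ⊥-elim (distinct m′ m m′<m m<a (sym eq))

  module _ {u w} (R : Walk G u w) where

    EdgeFamily : ℕ → (ℕ → Edge) → Set
    EdgeFamily a E = (∀ m → m < a → Uses R (E m)) × (∀ m m′ → m < a → m′ < a → m ≢ m′ → ¬ SameEdge (E m) (E m′))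

    rainbow⇒family≤colours : Rainbow R → ∀ {a E} → EdgeFamily a E → a ≤ k
    rainbow⇒family≤colours rainbow {a} {E} (uses , distinct) = distinct-colours⇒≤ a E λ m m′ m<m′ m′<a →
      distinct m m′ (<-trans m<m′ m′<a) m′<a (<⇒≢ m<m′)
      ∘ rainbow⇒colour-injective R rainbow (uses m (<-trans m<m′ m′<a)) (uses m′ m′<a)

    extend : ∀ {a E e} → EdgeFamily a E → Uses R e → (∀ m → m < a → ¬ SameEdge e (E m)) → EdgeFamily (suc a) (e ◃ E)
    extend {a} {E} {e} (uses , distinct) uses-e new = uses′ , distinct′
      where
      uses′ : ∀ m → m < suc a → Uses R ((e ◃ E) m)
      uses′ zero    _   = uses-e
      uses′ (suc m) m<a = uses m (≤-pred m<a)
      distinct′ : ∀ m m′ → m < suc a → m′ < suc a → m ≢ m′ → ¬ SameEdge ((e ◃ E) m) ((e ◃ E) m′)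
      distinct′ zero    zero     _   _    0≢0 = ⊥-elim (0≢0 refl)
      distinct′ zero    (suc m′) _   m′<a _   = new m′ (≤-pred m′<a)
      distinct′ (suc m) zero     m<a _    _   = new m (≤-pred m<a) ∘ SameEdge-sym
      distinct′ (suc m) (suc m′) m<a m′<a m≢m′ = distinct m m′ (≤-pred m<a) (≤-pred m′<a) (m≢m′ ∘ cong suc)

-- For q = t = r-1 this is the complete graph on {0, t, ..., n-1} with the path 0 - 1 - ... - t
-- attached; for q = t+1 = r-1 it lacks the edge {0, t}.
module PathClique (n t q : ℕ) where

  UpEdge : ℕ → ℕ → Set
  UpEdge x y = x < y × (y ≡ suc x ⊎ t ≤ x ⊎ x ≡ 0 × q ≤ y)

  upEdge? : ∀ x y → Dec (UpEdge x y)
  upEdge? x y = (x <? y) ×-dec ((y ≟ suc x) ⊎-dec (t ≤? x) ⊎-dec ((x ≟ 0) ×-dec (q ≤? y)))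

  Adj : ℕ → ℕ → Set
  Adj x y = UpEdge x y ⊎ UpEdge y x

  adj? : ∀ x y → Dec (Adj x y)
  adj? x y = upEdge? x y ⊎-dec upEdge? y x

  Adj-sym : ∀ {x y} → Adj x y → Adj y x
  Adj-sym (inj₁ xy) = inj₂ xy
  Adj-sym (inj₂ yx) = inj₁ yx

  Adj-irrefl : ∀ {x y} → Adj x y → x ≢ y
  Adj-irrefl (inj₁ (x<y , _)) refl = <-irrefl refl x<y
  Adj-irrefl (inj₂ (y<x , _)) refl = <-irrefl refl y<x

  adjᵇ : ℕ → ℕ → Bool
  adjᵇ x y = isYes (adj? x y)

  G : Graph n
  G = record
    { adj    = λ i j → adjᵇ (toℕ i) (toℕ j)
    ; sym    = λ i j → symmetric (toℕ i) (toℕ j)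
    ; irrefl = λ i → irreflexive (toℕ i)
    }
    where
    symmetric : ∀ x y → adjᵇ x y ≡ adjᵇ y x
    symmetric x y with adj? x y | adj? y x
    ... | yes _  | yes _  = refl
    ... | no _   | no _   = refl
    ... | yes xy | no ¬yx = ⊥-elim (¬yx (Adj-sym xy))
    ... | no ¬xy | yes yx = ⊥-elim (¬xy (Adj-sym yx))
    irreflexive : ∀ x → adjᵇ x x ≡ false
    irreflexive x with adj? x x
    ... | yes xx = ⊥-elim (Adj-irrefl xx refl)
    ... | no _   = refl

  adjacent⇒Adj : ∀ {i j : Fin n} → T (adj G i j) → Adj (toℕ i) (toℕ j)
  adjacent⇒Adj {i} {j} e with adj? (toℕ i) (toℕ j)
  ... | yes ij = ij

  Adj⇒adjacent : ∀ {i j : Fin n} → Adj (toℕ i) (toℕ j) → T (adj G i j)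
  Adj⇒adjacent {i} {j} ij with adj? (toℕ i) (toℕ j)
  ... | yes _   = tt
  ... | no ¬ij  = ¬ij ij

  indicator : ℕ → ℕ → ℕ
  indicator a b = if (a <ᵇ b) ∧ adjᵇ a b then 1 else 0

  indicator≡1 : ∀ {a b} → a < b → Adj a b → indicator a b ≡ 1
  indicator≡1 {a} {b} a<b ab with a <ᵇ b | <⇒<ᵇ a<b | adj? a b
  ... | true | _ | yes _  = refl
  ... | true | _ | no ¬ab = ⊥-elim (¬ab ab)

  edge-classes≤indicator : 1 ≤ t → 2 ≤ q → ∀ a b →
    𝟙 (b ≟ suc a) + 𝟙 ((t ≤? a) ×-dec (2 + a ≤? b)) + 𝟙 ((a ≟ 0) ×-dec (q ≤? b)) ≤ indicator a b
  edge-classes≤indicator 1≤t 2≤q a b = classes (b ≟ suc a) ((t ≤? a) ×-dec (2 + a ≤? b)) ((a ≟ 0) ×-dec (q ≤? b))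
    where
    edge : UpEdge a b → 1 ≤ indicator a b
    edge ab = ≤-reflexive (sym (indicator≡1 (proj₁ ab) (inj₁ ab)))
    classes : (path : Dec (b ≡ suc a)) (chord : Dec (t ≤ a × 2 + a ≤ b)) (fan : Dec (a ≡ 0 × q ≤ b)) →
              𝟙 path + 𝟙 chord + 𝟙 fan ≤ indicator a b
    classes (no _)   (no _)              (no _)            = z≤n
    classes (yes b≡) (no _)              (no _)            = edge (≤-reflexive (sym b≡) , inj₁ b≡)
    classes (no _)   (yes (t≤a , 2+a≤b)) (no _)            = edge (≤-trans (n≤1+n _) 2+a≤b , inj₂ (inj₁ t≤a))
    classes (no _)   (no _)              (yes (refl , q≤b)) = edge (≤-trans (≤-trans (s≤s z≤n) 2≤q) q≤b , inj₂ (inj₂ (refl , q≤b)))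
    classes (yes b≡) (yes (_ , 2+a≤b))   _                 = ⊥-elim (<-irrefl (sym b≡) 2+a≤b)
    classes (yes refl) (no _)            (yes (refl , q≤1)) = ⊥-elim (<-irrefl refl (≤-trans 2≤q q≤1))
    classes (no _)   (yes (t≤a , _))     (yes (refl , _))  = ⊥-elim (<-irrefl refl (≤-trans 1≤t t≤a))

  edgeCount-lower-bound : 1 ≤ t → 2 ≤ q → 1 ≤ n → (n ∸ 1) + (n ∸ t ∸ 1) C 2 + (n ∸ q) ≤ edgeCount G
  edgeCount-lower-bound 1≤t 2≤q 1≤n = begin
    (n ∸ 1) + (n ∸ t ∸ 1) C 2 + (n ∸ q)
      ≡⟨ sym (cong₂ _+_ (cong₂ _+_ (count-successor-pairs n) (count-gapped-pairs t n)) (count-row-zero n q 1≤n)) ⟩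
    ∑[ a < n ] ∑[ b < n ] path a b + ∑[ a < n ] ∑[ b < n ] chord a b + ∑[ a < n ] ∑[ b < n ] fan a b
      ≡⟨ cong (_+ ∑[ a < n ] ∑[ b < n ] fan a b) (sym (∑²-distrib-+ n n path chord)) ⟩
    ∑[ a < n ] ∑[ b < n ] (path a b + chord a b) + ∑[ a < n ] ∑[ b < n ] fan a b
      ≡⟨ sym (∑²-distrib-+ n n (λ a b → path a b + chord a b) fan) ⟩
    ∑[ a < n ] ∑[ b < n ] (path a b + chord a b + fan a b)
      ≤⟨ ∑<-mono-≤ n (λ a → ∑<-mono-≤ n (edge-classes≤indicator 1≤t 2≤q a)) ⟩
    ∑[ a < n ] ∑[ b < n ] indicator a b
      ≡⟨ sym (edgeCount-labelled G adjᵇ (λ _ _ → refl)) ⟩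
    edgeCount G ∎
    where
    open ≤-Reasoning
    path chord fan : ℕ → ℕ → ℕ
    path  a b = 𝟙 (b ≟ suc a)
    chord a b = 𝟙 ((t ≤? a) ×-dec (2 + a ≤? b))
    fan   a b = 𝟙 ((a ≟ 0) ×-dec (q ≤? b))

  twoConnected : 2 ≤ q → q < n → TwoConnected G
  twoConnected 2≤q q<n = HamiltonianCycle.hamiltonian⇒twoConnected G consecutive first-last (≤-trans (s≤s 2≤q) q<n)
    where
    consecutive : ∀ (x y : Fin n) → toℕ y ≡ suc (toℕ x) → T (adj G x y)
    consecutive x y y≡ = Adj⇒adjacent {x} {y} (inj₁ (≤-reflexive (sym y≡) , inj₁ y≡))
    first-last : ∀ (x y : Fin n) → toℕ x ≡ 0 → suc (toℕ y) ≡ n → T (adj G x y)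
    first-last x y x≡0 y≡ =
      Adj⇒adjacent {x} {y} (inj₁ (subst (_< toℕ y) (sym x≡0) (≤-trans (≤-trans (s≤s z≤n) 2≤q) q≤y) , inj₂ (inj₂ (x≡0 , q≤y))))
      where
      q≤y : q ≤ toℕ y
      q≤y = s≤s⁻¹ (subst (q <_) (sym y≡) q<n)

  interior-neighbours : t ≤ q → ∀ {y x} → 1 ≤ y → y < t → Adj y x → x ≡ suc y ⊎ suc x ≡ y
  interior-neighbours t≤q 1≤y y<t (inj₁ (_ , inj₁ x≡))                 = inj₁ x≡
  interior-neighbours t≤q 1≤y y<t (inj₁ (_ , inj₂ (inj₁ t≤y)))         = ⊥-elim (<⇒≱ y<t t≤y)
  interior-neighbours t≤q 1≤y y<t (inj₁ (_ , inj₂ (inj₂ (refl , _))))  = ⊥-elim (<⇒≱ 1≤y z≤n)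
  interior-neighbours t≤q 1≤y y<t (inj₂ (_ , inj₁ y≡))                 = inj₂ (sym y≡)
  interior-neighbours t≤q 1≤y y<t (inj₂ (x<y , inj₂ (inj₁ t≤x)))       = ⊥-elim (<⇒≱ (<-trans x<y y<t) t≤x)
  interior-neighbours t≤q 1≤y y<t (inj₂ (_ , inj₂ (inj₂ (_ , q≤y))))   = ⊥-elim (<⇒≱ y<t (≤-trans t≤q q≤y))

module PathCliqueColourings {n t q k : ℕ} (t≤q : t ≤ q) (2≤t : 2 ≤ t)
  (c : Colouring (PathClique.G n t q) k) (v₀ : Fin n) (κ₀ : Fin k) where

  open PathClique n t q
  open RainbowPaths c v₀ κ₀

  labelled-Adj : ∀ {u w} (p : Walk G u w) {x y κ} → ((x , y) , κ) ∈ edges p → Adj x y × x < n × y < n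
  labelled-Adj p e∈ with edge-adjacent p e∈
  ... | a , b , refl , refl , e = adjacent⇒Adj {a} {b} e , toℕ<n a , toℕ<n b

  Beyond : Edge → Set
  Beyond (x , y) = t < x ⊎ t < y

  beyond⇒not-path-edge : ∀ {e j} → Beyond e → j < t → ¬ SameEdge e (j , suc j)
  beyond⇒not-path-edge (inj₁ t<x) j<t (inj₁ (refl , _)) = <-asym t<x j<t
  beyond⇒not-path-edge (inj₂ t<y) j<t (inj₁ (_ , refl)) = <⇒≱ t<y j<t
  beyond⇒not-path-edge (inj₁ t<x) j<t (inj₂ (refl , _)) = <⇒≱ t<x j<t
  beyond⇒not-path-edge (inj₂ t<y) j<t (inj₂ (_ , refl)) = <-asym t<y j<t

  path-edge-except : ℕ → ℕ → Edge
  path-edge-except i m = punchIn i m , suc (punchIn i m)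

  t∸1+1 : suc (t ∸ 1) ≡ t
  t∸1+1 = m+[n∸m]≡n (≤-trans (s≤s z≤n) 2≤t)

  path-edge-except-< : ∀ i m → m < t ∸ 1 → punchIn i m < t
  path-edge-except-< i m m<t∸1 = subst (punchIn i m <_) t∸1+1 (punchIn-< i m m<t∸1)

  -- R is a rainbow path from i to i+1 avoiding the edge {i, i+1}; each lemma locates the edge by
  -- which R first enters a suitable set of labels.
  module AroundPair {u w : Fin n} (D : Detour u w) {i : ℕ} (u≡i : toℕ u ≡ i) (w≡1+i : toℕ w ≡ suc i) (i<t : i < t) where

    open Detour D public renaming (path to R)

    not-pair-edge : ∀ {x y κ} → ((x , y) , κ) ∈ edges R → x ≡ i → y ≡ suc i → ⊥
    not-pair-edge e∈ refl refl = avoids-uw e∈ (inj₁ (sym u≡i , sym w≡1+i))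

    u∉above : ¬ (suc i ≤ toℕ u)
    u∉above 1+i≤u = <-irrefl refl (subst (suc i ≤_) u≡i 1+i≤u)

    w-above : suc i ≤ toℕ w
    w-above = ≤-reflexive (sym w≡1+i)

    path-edge-below : ∀ {j x y κ} → j < i → ((x , y) , κ) ∈ edges R → j < x → x ≤ i → y ≤ j ⊎ i < y →
                      Uses R (j , suc j)
    path-edge-below {j} {x} j<i e∈ j<x x≤i Py
      with interior-neighbours t≤q (≤-trans (s≤s z≤n) j<x) (≤-<-trans x≤i i<t) (proj₁ (labelled-Adj R e∈)) | Py
    ... | inj₁ refl | inj₁ x<j   = ⊥-elim (<-asym j<x x<j)
    ... | inj₁ refl | inj₂ i<1+x = ⊥-elim (not-pair-edge e∈ x≡i (cong suc x≡i))
      where x≡i = ≤-antisym x≤i (s≤s⁻¹ i<1+x)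
    ... | inj₂ refl | inj₁ y≤j   = uses-backward R e∈ (cong suc y≡j) y≡j
      where y≡j = ≤-antisym y≤j (s≤s⁻¹ j<x)
    ... | inj₂ refl | inj₂ i<y   = ⊥-elim (<-asym i<y x≤i)

    path-edge-above : ∀ {j x y κ} → j < t → ((x , y) , κ) ∈ edges R → ¬ (suc i ≤ x × x ≤ j) → i < y → y ≤ j →
                      Uses R (j , suc j)
    path-edge-above {j} {x} j<t e∈ ¬Px i<y y≤j
      with interior-neighbours t≤q (≤-trans (s≤s z≤n) i<y) (≤-<-trans y≤j j<t) (Adj-sym (proj₁ (labelled-Adj R e∈)))
    ... | inj₁ refl = uses-backward R e∈ (cong suc y≡j) y≡j
      where y≡j = ≤-antisym y≤j (s≤s⁻¹ (≰⇒> (λ 1+y≤j → ¬Px (s≤s (<⇒≤ i<y) , 1+y≤j))))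
    ... | inj₂ refl = ⊥-elim (not-pair-edge e∈ x≡i (cong suc x≡i))
      where x≡i = ≤-antisym (s≤s⁻¹ (≰⇒> (λ 1+i≤x → ¬Px (1+i≤x , ≤-trans (n≤1+n x) y≤j)))) (s≤s⁻¹ i<y)

    uses-path-edge : ∀ j → j < t → j ≢ i → Uses R (j , suc j)
    uses-path-edge j j<t j≢i with <-cmp j i
    ... | tri≈ _ j≡i _ = ⊥-elim (j≢i j≡i)
    ... | tri< j<i _ _ =
      let _ , _ , _ , e∈ , ¬Px , Py = crossing-edge R (λ x → x ≤ j ⊎ i < x) (λ x → (x ≤? j) ⊎-dec (i <? x))
                                        (λ { (inj₁ u≤j) → <⇒≱ j<i (subst (_≤ j) u≡i u≤j) ; (inj₂ i<u) → <-irrefl (sym u≡i) i<u })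
                                        (inj₂ w-above)
      in path-edge-below j<i e∈ (≰⇒> (¬Px ∘ inj₁)) (≮⇒≥ (¬Px ∘ inj₂)) Py
    ... | tri> _ _ i<j =
      let _ , _ , _ , e∈ , ¬Px , (i<y , y≤j) = crossing-edge R (λ x → suc i ≤ x × x ≤ j) (λ x → (suc i ≤? x) ×-dec (x ≤? j))
                                                 (u∉above ∘ proj₁) (w-above , subst (_≤ j) (sym w≡1+i) i<j)
      in path-edge-above j<t e∈ ¬Px i<y y≤j

    uses-fan-edge : Σ ℕ λ d → q ≤ d × d < n × Uses R (0 , d)
    uses-fan-edge with crossing-edge R (suc i ≤_) (suc i ≤?_) u∉above w-above
    ... | x , y , _ , e∈ , ¬Px , 1+i≤y with labelled-Adj R e∈
    ...   | inj₁ (_ , inj₁ y≡1+x) , _ = ⊥-elim (not-pair-edge e∈ x≡i (trans y≡1+x (cong suc x≡i)))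
      where x≡i = ≤-antisym (s≤s⁻¹ (≰⇒> ¬Px)) (s≤s⁻¹ (subst (suc i ≤_) y≡1+x 1+i≤y))
    ...   | inj₁ (_ , inj₂ (inj₁ t≤x)) , _              = ⊥-elim (<⇒≱ (≤-<-trans (s≤s⁻¹ (≰⇒> ¬Px)) i<t) t≤x)
    ...   | inj₁ (_ , inj₂ (inj₂ (x≡0 , q≤y))) , _ , y<n = y , q≤y , y<n , uses-forward R e∈ x≡0 refl
    ...   | inj₂ (y<x , _) , _                          = ⊥-elim (<⇒≱ (<-≤-trans y<x (s≤s⁻¹ (≰⇒> ¬Px))) (<⇒≤ 1+i≤y))

    InSegment : ℕ → Set
    InSegment x = suc i ≤ x × x ≤ t

    inSegment? : ∀ x → Dec (InSegment x)
    inSegment? x = (suc i ≤? x) ×-dec (x ≤? t)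

    w∈segment : InSegment (toℕ w)
    w∈segment = w-above , subst (_≤ t) (sym w≡1+i) i<t

    entering-segment : ∀ {x y κ} → ((x , y) , κ) ∈ edges R → ¬ InSegment x → InSegment y →
                       (x ≡ 0 × y ≡ t × q ≤ t) ⊎ (y ≡ t × t < x)
    entering-segment {x} {y} e∈ ¬Px (1+i≤y , y≤t) with proj₁ (labelled-Adj R e∈)
    ... | inj₁ (x<y , inj₁ y≡1+x) = ⊥-elim (not-pair-edge e∈ x≡i (trans y≡1+x (cong suc x≡i)))
      where x≡i = ≤-antisym (s≤s⁻¹ (≰⇒> (λ 1+i≤x → ¬Px (1+i≤x , ≤-trans (<⇒≤ x<y) y≤t))))
                            (s≤s⁻¹ (subst (suc i ≤_) y≡1+x 1+i≤y))
    ... | inj₁ (x<y , inj₂ (inj₁ t≤x))       = ⊥-elim (<⇒≱ (<-≤-trans x<y y≤t) t≤x)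
    ... | inj₁ (_ , inj₂ (inj₂ (x≡0 , q≤y))) = inj₁ (x≡0 , ≤-antisym y≤t (≤-trans t≤q q≤y) , ≤-trans q≤y y≤t)
    ... | inj₂ (y<x , x-edge)                = inj₂ (≤-antisym y≤t (t≤y x-edge) , t<x)
      where
      t<x : t < x
      t<x = ≰⇒> (λ x≤t → ¬Px (≤-trans 1+i≤y (<⇒≤ y<x) , x≤t))
      t≤y : x ≡ suc y ⊎ t ≤ y ⊎ y ≡ 0 × q ≤ x → t ≤ y
      t≤y (inj₁ x≡1+y)             = s≤s⁻¹ (subst (t <_) x≡1+y t<x)
      t≤y (inj₂ (inj₁ t≤y))        = t≤y
      t≤y (inj₂ (inj₂ (y≡0 , _))) = ⊥-elim (n≮0 (subst (suc i ≤_) y≡0 1+i≤y))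

    uses-edge-at-t : (q ≤ t × Uses R (0 , t)) ⊎ (Σ ℕ λ d′ → t < d′ × Uses R (t , d′))
    uses-edge-at-t with crossing-edge R InSegment inSegment? (u∉above ∘ proj₁) w∈segment
    ... | x , y , _ , e∈ , ¬Px , Py with entering-segment e∈ ¬Px Py
    ...   | inj₁ (x≡0 , y≡t , q≤t) = inj₁ (q≤t , uses-forward R e∈ x≡0 y≡t)
    ...   | inj₂ (y≡t , t<x)       = inj₂ (x , t<x , uses-backward R e∈ refl y≡t)

    uses-third-edge : q ≡ suc t → ∀ {d d′} → t < d → t < d′ → d ≢ d′ →
                      Σ Edge λ e → Uses R e × Beyond e × ¬ SameEdge e (0 , d) × ¬ SameEdge e (t , d′)
    uses-third-edge q≡1+t {d} {d′} t<d t<d′ d≢d′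
      with crossing-edge R (λ x → InSegment x ⊎ x ≡ d′) (λ x → inSegment? x ⊎-dec (x ≟ d′))
             (λ { (inj₁ (1+i≤u , _)) → u∉above 1+i≤u ; (inj₂ u≡d′) → <-irrefl (trans (sym u≡i) u≡d′) (<-trans i<t t<d′) })
             (inj₁ w∈segment)
    ... | x , y , _ , e∈ , ¬Px , inj₂ y≡d′ =
      (x , d′) , uses-forward R e∈ refl y≡d′ , inj₂ t<d′
      , (λ { (inj₁ (_ , d′≡d)) → d≢d′ (sym d′≡d) ; (inj₂ (_ , d′≡0)) → n≮0 (subst (t <_) d′≡0 t<d′) })
      , (λ { (inj₁ (refl , _)) → ¬Px (inj₁ (i<t , ≤-refl)) ; (inj₂ (x≡d′ , _)) → ¬Px (inj₂ x≡d′) })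
    ... | x , y , _ , e∈ , ¬Px , inj₁ Py with entering-segment e∈ (¬Px ∘ inj₁) Py
    ...   | inj₁ (_ , _ , q≤t) = ⊥-elim (<-irrefl refl (subst (_≤ t) q≡1+t q≤t))
    ...   | inj₂ (y≡t , t<x)   =
      (x , t) , uses-forward R e∈ refl y≡t , inj₁ t<x
      , (λ { (inj₁ (x≡0 , _)) → n≮0 (subst (t <_) x≡0 t<x) ; (inj₂ (_ , t≡0)) → n≮0 (subst (1 <_) t≡0 2≤t) })
      , (λ { (inj₁ (x≡t , _)) → <-irrefl (sym x≡t) t<x ; (inj₂ (x≡d′ , _)) → ¬Px (inj₂ x≡d′) })

    path-family : EdgeFamily R (t ∸ 1) (path-edge-except i)
    path-family = (λ m m<t∸1 → uses-path-edge (punchIn i m) (path-edge-except-< i m m<t∸1) (punchInᵢ≢i i m)) , distinct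
      where
      distinct : ∀ m m′ → m < t ∸ 1 → m′ < t ∸ 1 → m ≢ m′ → ¬ SameEdge (path-edge-except i m) (path-edge-except i m′)
      distinct m m′ _ _ m≢m′ (inj₁ (eq , _))     = m≢m′ (punchIn-injective i m m′ eq)
      distinct m m′ _ _ _    (inj₂ (eq₁ , eq₂)) = <-irrefl (trans eq₁ (sym (cong suc eq₂))) (<-trans (n<1+n _) (n<1+n _))

    wide-family : ∀ {d d′} → t < d → t < d′ → Uses R (0 , d) → Uses R (t , d′) →
                  EdgeFamily R (suc (suc (t ∸ 1))) ((0 , d) ◃ (t , d′) ◃ path-edge-except i)
    wide-family t<d t<d′ uses-0d uses-td′ =
      extend R (extend R path-family uses-td′ (λ m m< → beyond⇒not-path-edge (inj₂ t<d′) (path-edge-except-< i m m<)))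
             uses-0d new
      where
      new : ∀ m → m < suc (t ∸ 1) → ¬ SameEdge (0 , _) (((t , _) ◃ path-edge-except i) m)
      new zero    _  (inj₁ (0≡t , _))  = <-irrefl 0≡t (≤-trans (s≤s z≤n) 2≤t)
      new zero    _  (inj₂ (0≡d′ , _)) = <-irrefl 0≡d′ (≤-<-trans z≤n t<d′)
      new (suc m) m< = beyond⇒not-path-edge (inj₂ t<d) (path-edge-except-< i m (s≤s⁻¹ m<))

    family≤colours : ∀ {a E} → EdgeFamily R a E → a ≤ k
    family≤colours = rainbow⇒family≤colours R rainbow

    two-clique-edges⇒⊥ : k ≤ t → ∀ {d d′} → t < d → t < d′ → Uses R (0 , d) → Uses R (t , d′) → ⊥
    two-clique-edges⇒⊥ k≤t t<d t<d′ uses-0d uses-td′ =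
      <⇒≱ (s≤s k≤t) (subst (_≤ k) (cong suc t∸1+1) (family≤colours (wide-family t<d t<d′ uses-0d uses-td′)))

    three-clique-edges⇒⊥ : q ≡ suc t → k ≤ suc t → ∀ {d d′} → t < d → t < d′ → d ≢ d′ →
                           Uses R (0 , d) → Uses R (t , d′) → ⊥
    three-clique-edges⇒⊥ q≡1+t k≤1+t {d} {d′} t<d t<d′ d≢d′ uses-0d uses-td′
      with uses-third-edge q≡1+t t<d t<d′ d≢d′
    ... | e , uses-e , beyond , not-0d , not-td′ =
      <⇒≱ (s≤s k≤1+t) (subst (_≤ k) (cong (suc ∘ suc) t∸1+1)
                               (family≤colours (extend R (wide-family t<d t<d′ uses-0d uses-td′) uses-e new)))
      where
      new : ∀ m → m < suc (suc (t ∸ 1)) → ¬ SameEdge e (((0 , d) ◃ (t , d′) ◃ path-edge-except i) m)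
      new zero          _  = not-0d
      new (suc zero)    _  = not-td′
      new (suc (suc m)) m< = beyond⇒not-path-edge beyond (path-edge-except-< i m (s≤s⁻¹ (s≤s⁻¹ m<)))

    -- Abstract, so that case splits on these results never unfold their proofs.
    abstract
      uses-0t : q ≡ t → k ≤ t → Uses R (0 , t)
      uses-0t q≡t k≤t with uses-fan-edge | uses-edge-at-t
      ... | _ | inj₁ (_ , uses-0t) = uses-0t
      ... | d , q≤d , _ , uses-0d | inj₂ (d′ , t<d′ , uses-td′) with d ≟ t
      ...   | yes refl = uses-0d
      ...   | no d≢t   = ⊥-elim (two-clique-edges⇒⊥ k≤t (≤∧≢⇒< (subst (_≤ d) q≡t q≤d) (d≢t ∘ sym)) t<d′ uses-0d uses-td′)

      common-fan-vertex : q ≡ suc t → k ≤ suc t → Σ ℕ λ d → t < d × d < n × Uses R (0 , d) × Uses R (t , d)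
      common-fan-vertex q≡1+t k≤1+t with uses-fan-edge | uses-edge-at-t
      ... | _ | inj₁ (q≤t , _) = ⊥-elim (<-irrefl refl (subst (_≤ t) q≡1+t q≤t))
      ... | d , q≤d , d<n , uses-0d | inj₂ (d′ , t<d′ , uses-td′) with d ≟ d′
      ...   | yes refl = d , subst (_≤ d) q≡1+t q≤d , d<n , uses-0d , uses-td′
      ...   | no d≢d′  = ⊥-elim (three-clique-edges⇒⊥ q≡1+t k≤1+t (subst (_≤ d) q≡1+t q≤d) t<d′ d≢d′ uses-0d uses-td′)

module RainbowTwoConnected {n t q k : ℕ} (t≤q : t ≤ q) (2≤t : 2 ≤ t) (q<n : q < n)
  (c : Colouring (PathClique.G n t q) k) (r2c : Rainbow2Connected (PathClique.G n t q) c) where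

  open PathClique n t q

  t<n : t < n
  t<n = ≤-<-trans t≤q q<n

  vertex : ∀ {x} → x < n → Fin n
  vertex x<n = fromℕ< x<n

  0<n : 0 < n
  0<n = ≤-<-trans z≤n t<n

  1<n : 1 < n
  1<n = ≤-<-trans (≤-trans (s≤s z≤n) 2≤t) t<n

  edge-01 : T (adj G (vertex 0<n) (vertex 1<n))
  edge-01 = Adj⇒adjacent {vertex 0<n} {vertex 1<n}
    (subst₂ Adj (sym (toℕ-fromℕ< 0<n)) (sym (toℕ-fromℕ< 1<n)) (inj₁ (s≤s z≤n , inj₁ refl)))

  open PathCliqueColourings t≤q 2≤t c (vertex 0<n) (col c _ _ edge-01) public
  open RainbowPaths c (vertex 0<n) (col c _ _ edge-01) public

  pair-detour : ∀ i (i<t : i < t) → Detour (vertex (<-trans i<t t<n)) (vertex (≤-<-trans i<t t<n))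
  pair-detour i i<t = detour r2c _ _ λ u≡w → <-irrefl (trans (sym (toℕ-fromℕ< _)) (trans (cong toℕ u≡w) (toℕ-fromℕ< _))) (n<1+n i)

  module Around (i : ℕ) (i<t : i < t) = AroundPair (pair-detour i i<t) (toℕ-fromℕ< _) (toℕ-fromℕ< _) i<t

  seen-together : ∀ i (i<t : i < t) {e e′} → Uses (Around.R i i<t) e → Uses (Around.R i i<t) e′ →
                  ¬ SameEdge e e′ → colour e ≢ colour e′
  seen-together i i<t uses uses′ not-same = not-same ∘ rainbow⇒colour-injective _ (Around.rainbow i i<t) uses uses′

  path-edges-distinct : ∀ {j j′} → j < j′ → ¬ SameEdge (j , suc j) (j′ , suc j′)
  path-edges-distinct j<j′ (inj₁ (j≡j′ , _))   = <-irrefl j≡j′ j<j′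
  path-edges-distinct j<j′ (inj₂ (j≡1+j′ , _)) = <-asym j<j′ (subst (_ <_) (sym j≡1+j′) (n<1+n _))

  path-edge-colours-distinct : 3 ≤ t → ∀ {j j′} → j < j′ → j′ < t → colour (j , suc j) ≢ colour (j′ , suc j′)
  path-edge-colours-distinct 3≤t {j} {j′} j<j′ j′<t =
    let i , i<3 , i≢j , i≢j′ = avoid-two j j′
        i<t = <-≤-trans i<3 3≤t
    in seen-together i i<t (Around.uses-path-edge i i<t j (<-trans j<j′ j′<t) (i≢j ∘ sym))
                           (Around.uses-path-edge i i<t j′ j′<t (i≢j′ ∘ sym)) (path-edges-distinct j<j′)

  needs-1+t-colours : q ≡ t → 3 ≤ t → k ≤ t → ⊥
  needs-1+t-colours q≡t 3≤t k≤t = <⇒≱ (s≤s k≤t) (distinct-colours⇒≤ (suc t) E distinct)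
    where
    E : ℕ → Edge
    E zero    = 0 , t
    E (suc j) = j , suc j
    distinct : ∀ m m′ → m < m′ → m′ < suc t → colour (E m) ≢ colour (E m′)
    distinct zero    (suc j)  _     j<t  =
      let i , i<3 , i≢j , _ = avoid-two j j
          i<t = <-≤-trans i<3 3≤t
      in seen-together i i<t (Around.uses-0t i i<t q≡t k≤t) (Around.uses-path-edge i i<t j (s≤s⁻¹ j<t) (i≢j ∘ sym))
           (λ { (inj₁ (refl , t≡1)) → <-irrefl (sym t≡1) 2≤t ; (inj₂ (() , _)) })
    distinct (suc j) (suc j′) j<j′ j′<t = path-edge-colours-distinct 3≤t (s≤s⁻¹ j<j′) (s≤s⁻¹ j′<t)

  FanPair : ℕ → ∀ i → i < t → Set
  FanPair d i i<t = Uses (Around.R i i<t) (0 , d) × Uses (Around.R i i<t) (t , d)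

  abstract
    shared-fan-vertex : q ≡ suc t → n ∸ suc t < t → k ≤ suc t →
                        Σ ℕ λ d → t < d × ∀ j → Σ ℕ λ i → Σ (i < t) λ i<t → i ≢ j × FanPair d i i<t
    shared-fan-vertex q≡1+t small k≤1+t =
      let a₁ , a₂ , a₁≢a₂ , same = pigeonhole-range (proj₁ ∘ fan-vertex) bounds small
      in proj₁ (fan-vertex a₁) , proj₁ (proj₂ (fan-vertex a₁)) , witness a₁ a₂ a₁≢a₂ same
      where
      fan-vertex : (a : Fin t) → Σ ℕ λ d → t < d × d < n × FanPair d (toℕ a) (toℕ<n a)
      fan-vertex a = Around.common-fan-vertex (toℕ a) (toℕ<n a) q≡1+t k≤1+t
      bounds : ∀ a → suc t ≤ proj₁ (fan-vertex a) × proj₁ (fan-vertex a) < n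
      bounds a = proj₁ (proj₂ (fan-vertex a)) , proj₁ (proj₂ (proj₂ (fan-vertex a)))
      witness : ∀ a₁ a₂ → a₁ ≢ a₂ → proj₁ (fan-vertex a₁) ≡ proj₁ (fan-vertex a₂) →
                ∀ j → Σ ℕ λ i → Σ (i < t) λ i<t → i ≢ j × FanPair (proj₁ (fan-vertex a₁)) i i<t
      witness a₁ a₂ a₁≢a₂ same j with toℕ a₁ ≟ j
      ... | no a₁≢j  = toℕ a₁ , toℕ<n a₁ , a₁≢j , proj₂ (proj₂ (proj₂ (fan-vertex a₁)))
      ... | yes a₁≡j = toℕ a₂ , toℕ<n a₂ , (λ a₂≡j → a₁≢a₂ (toℕ-injective (trans a₁≡j (sym a₂≡j))))
                       , subst (λ d → FanPair d (toℕ a₂) (toℕ<n a₂)) (sym same) (proj₂ (proj₂ (proj₂ (fan-vertex a₂))))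

  needs-2+t-colours : q ≡ suc t → 3 ≤ t → n ∸ suc t < t → k ≤ suc t → ⊥
  needs-2+t-colours q≡1+t 3≤t small k≤1+t with shared-fan-vertex q≡1+t small k≤1+t
  ... | d , t<d , witness = <⇒≱ (s≤s k≤1+t) (distinct-colours⇒≤ (suc (suc t)) E distinct)
    where
    E : ℕ → Edge
    E zero          = 0 , d
    E (suc zero)    = t , d
    E (suc (suc j)) = j , suc j
    fan-vs-path : ∀ {x} j → j < t → (∀ i i<t → FanPair d i i<t → Uses (Around.R i i<t) (x , d)) →
                  colour (x , d) ≢ colour (j , suc j)
    fan-vs-path j j<t uses-e =
      let i , i<t , i≢j , fan = witness j
      in seen-together i i<t (uses-e i i<t fan) (Around.uses-path-edge i i<t j j<t (i≢j ∘ sym))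
                       (beyond⇒not-path-edge (inj₂ t<d) j<t)
    distinct : ∀ m m′ → m < m′ → m′ < suc (suc t) → colour (E m) ≢ colour (E m′)
    distinct zero          (suc zero)     _        _   =
      let i , i<t , _ , uses-0d , uses-td = witness 0
      in seen-together i i<t uses-0d uses-td
           (λ { (inj₁ (0≡t , _)) → <-irrefl 0≡t (≤-trans (s≤s z≤n) 2≤t) ; (inj₂ (_ , d≡t)) → <-irrefl (sym d≡t) t<d })
    distinct (suc zero)    (suc zero)     (s≤s ()) _
    distinct (suc (suc _)) (suc zero)     (s≤s ()) _
    distinct zero          (suc (suc j))  _        j<t  = fan-vs-path j (s≤s⁻¹ (s≤s⁻¹ j<t)) (λ _ _ → proj₁)
    distinct (suc zero)    (suc (suc j))  _        j<t  = fan-vs-path j (s≤s⁻¹ (s≤s⁻¹ j<t)) (λ _ _ → proj₂)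
    distinct (suc (suc j)) (suc (suc j′)) j<j′     j′<t =
      path-edge-colours-distinct 3≤t (s≤s⁻¹ (s≤s⁻¹ j<j′)) (s≤s⁻¹ (s≤s⁻¹ j′<t))

-- With two colours, the detours around {0,1} and {1,2} give c(01) = c(12) ≠ c(02).  Every z ≥ 3 is
-- reached from 1 by rainbow paths 1 - 0 - z and 1 - 2 - z, which forces c(0z) = c(2z) = c(02); so no
-- rainbow path 0 - y - 2 exists, and 0 and 2 have no detour.
module AtMostTwoColours {n k : ℕ} (2<n : 2 < n) (c : Colouring (PathClique.G n 2 2) k)
  (r2c : Rainbow2Connected (PathClique.G n 2 2) c) (k≤2 : k ≤ 2) where

  open PathClique n 2 2
  open RainbowTwoConnected ≤-refl ≤-refl 2<n c r2c

  no-three-edges : ∀ {u y z w} {e₁ : T (adj G u y)} {e₂ : T (adj G y z)} {e₃ : T (adj G z w)} {κs} →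
                   ¬ Unique (col c u y e₁ ∷ col c y z e₂ ∷ col c z w e₃ ∷ κs)
  no-three-edges ((κ₁≢κ₂ ∷ κ₁≢κ₃ ∷ _) ∷ (κ₂≢κ₃ ∷ _) ∷ _) = κ₁≢κ₂ (two-valued k≤2 _ _ _ κ₁≢κ₃ κ₂≢κ₃)

  two-step-colours : ∀ {u y w} {e₁ : T (adj G u y)} {e₂ : T (adj G y w)} {κs} →
                     Unique (col c u y e₁ ∷ col c y w e₂ ∷ κs) → colour (toℕ u , toℕ y) ≢ colour (toℕ y , toℕ w)
  two-step-colours {u} {y} {w} {e₁} {e₂} ((κ₁≢κ₂ ∷ _) ∷ _) eq =
    κ₁≢κ₂ (trans (sym (colour-edge u y e₁)) (trans eq (colour-edge y w e₂)))

  02≢12 : colour (0 , 2) ≢ colour (1 , 2)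
  02≢12 = seen-together 0 (s≤s z≤n) (Around.uses-0t 0 (s≤s z≤n) refl k≤2)
                                    (Around.uses-path-edge 0 (s≤s z≤n) 1 ≤-refl (λ ()))
                                    (λ { (inj₁ (() , _)) ; (inj₂ (() , _)) })

  02≢01 : colour (0 , 2) ≢ colour (0 , 1)
  02≢01 = seen-together 1 ≤-refl (Around.uses-0t 1 ≤-refl refl k≤2)
                                 (Around.uses-path-edge 1 ≤-refl 0 (s≤s z≤n) (λ ()))
                                 (λ { (inj₁ (_ , ())) ; (inj₂ (() , _)) })

  01≡12 : colour (0 , 1) ≡ colour (1 , 2)
  01≡12 = two-valued k≤2 _ _ (colour (0 , 2)) (02≢01 ∘ sym) (02≢12 ∘ sym)

  neighbour-of-1 : ∀ {x} → Adj 1 x → x ≡ 2 ⊎ x ≡ 0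
  neighbour-of-1 1x with interior-neighbours ≤-refl (s≤s z≤n) ≤-refl 1x
  ... | inj₁ x≡2   = inj₁ x≡2
  ... | inj₂ 1+x≡1 = inj₂ (suc-injective 1+x≡1)

  paths-from-1 : ∀ {u w} (p : Walk G u w) → toℕ u ≡ 1 → 3 ≤ toℕ w → Rainbow p →
    Σ (Fin n) λ y → (toℕ y ≡ 2 ⊎ toℕ y ≡ 0) × vertices G p ≡ u ∷ y ∷ w ∷ []
                  × colour (1 , toℕ y) ≢ colour (toℕ y , toℕ w)
  paths-from-1 [ u ] u≡1 3≤u _ = ⊥-elim (<⇒≱ (s≤s (s≤s z≤n)) (subst (3 ≤_) u≡1 3≤u))
  paths-from-1 (u ∷⟨ e ⟩ [ w ]) u≡1 3≤w _ with neighbour-of-1 (subst (λ x → Adj x (toℕ w)) u≡1 (adjacent⇒Adj {u} {w} e))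
  ... | inj₁ w≡2 = ⊥-elim (<⇒≱ ≤-refl (subst (3 ≤_) w≡2 3≤w))
  ... | inj₂ w≡0 = ⊥-elim (<⇒≱ (s≤s z≤n) (subst (3 ≤_) w≡0 3≤w))
  paths-from-1 (u ∷⟨ e₁ ⟩ (y ∷⟨ e₂ ⟩ [ w ])) u≡1 _ rainbow =
    y , neighbour-of-1 (subst (λ x → Adj x (toℕ y)) u≡1 (adjacent⇒Adj {u} {y} e₁)) , refl
      , subst (λ x → colour (x , toℕ y) ≢ colour (toℕ y , toℕ w)) u≡1 (two-step-colours rainbow)
  paths-from-1 (u ∷⟨ e₁ ⟩ (y ∷⟨ e₂ ⟩ (z ∷⟨ e₃ ⟩ p))) _ _ rainbow = ⊥-elim (no-three-edges rainbow)

  via-0-and-2 : ∀ z → 3 ≤ z → z < n → colour (1 , 0) ≢ colour (0 , z) × colour (1 , 2) ≢ colour (2 , z)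
  via-0-and-2 z 3≤z z<n with r2c (vertex 1<n) (vertex z<n) 1≢z
    where
    1≢z : vertex 1<n ≢ vertex z<n
    1≢z eq = <⇒≱ (s≤s (s≤s z≤n)) (subst (3 ≤_) (trans (sym (toℕ-fromℕ< z<n)) (trans (cong toℕ (sym eq)) (toℕ-fromℕ< 1<n))) 3≤z)
  ... | p , q , (_ , rainbow-p) , (_ , rainbow-q) , vp≢vq , _
    with paths-from-1 p (toℕ-fromℕ< 1<n) 3≤w rainbow-p | paths-from-1 q (toℕ-fromℕ< 1<n) 3≤w rainbow-q
    where
    3≤w : 3 ≤ toℕ (vertex z<n)
    3≤w = subst (3 ≤_) (sym (toℕ-fromℕ< z<n)) 3≤z
  ... | y , y-nbr , vp , colours-p | y′ , y′-nbr , vq , colours-q = combine y-nbr y′-nbr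
    where
    different : toℕ y ≢ toℕ y′
    different eq = vp≢vq (trans vp (trans (cong (λ v → _ ∷ v ∷ _ ∷ []) (toℕ-injective eq)) (sym vq)))
    retarget : ∀ {a a′ b} → a ≡ a′ → b ≡ z → colour (1 , a) ≢ colour (a , b) → colour (1 , a′) ≢ colour (a′ , z)
    retarget refl refl ≢ = ≢
    combine : (toℕ y ≡ 2 ⊎ toℕ y ≡ 0) → (toℕ y′ ≡ 2 ⊎ toℕ y′ ≡ 0) →
              colour (1 , 0) ≢ colour (0 , z) × colour (1 , 2) ≢ colour (2 , z)
    combine (inj₁ y≡2) (inj₁ y′≡2) = ⊥-elim (different (trans y≡2 (sym y′≡2)))
    combine (inj₂ y≡0) (inj₂ y′≡0) = ⊥-elim (different (trans y≡0 (sym y′≡0)))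
    combine (inj₁ y≡2) (inj₂ y′≡0) = retarget y′≡0 (toℕ-fromℕ< z<n) colours-q , retarget y≡2 (toℕ-fromℕ< z<n) colours-p
    combine (inj₂ y≡0) (inj₁ y′≡2) = retarget y≡0 (toℕ-fromℕ< z<n) colours-p , retarget y′≡2 (toℕ-fromℕ< z<n) colours-q

  middle-colours-agree : ∀ y → y < n → y ≢ 0 → y ≢ 2 → colour (0 , y) ≡ colour (y , 2)
  middle-colours-agree y y<n y≢0 y≢2 with y ≟ 1
  ... | yes refl = 01≡12
  ... | no y≢1   = begin
    colour (0 , y) ≡⟨ two-valued k≤2 _ _ (colour (0 , 1)) 0y≢01 02≢01 ⟩
    colour (0 , 2) ≡⟨ two-valued k≤2 _ _ (colour (0 , 1)) 02≢01 2y≢01 ⟩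
    colour (2 , y) ≡⟨ colour-sym 2 y ⟩
    colour (y , 2) ∎
    where
    open ≡-Reasoning
    3≤y : ∀ y → y ≢ 0 → y ≢ 1 → y ≢ 2 → 3 ≤ y
    3≤y 0                   y≢0 _   _   = ⊥-elim (y≢0 refl)
    3≤y 1                   _   y≢1 _   = ⊥-elim (y≢1 refl)
    3≤y 2                   _   _   y≢2 = ⊥-elim (y≢2 refl)
    3≤y (suc (suc (suc _))) _   _   _   = s≤s (s≤s (s≤s z≤n))
    via = via-0-and-2 y (3≤y y y≢0 y≢1 y≢2) y<n
    0y≢01 : colour (0 , y) ≢ colour (0 , 1)
    0y≢01 eq = proj₁ via (trans (colour-sym 1 0) (sym eq))
    2y≢01 : colour (2 , y) ≢ colour (0 , 1)
    2y≢01 eq = proj₂ via (trans (sym 01≡12) (sym eq))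

  needs-3-colours : ⊥
  needs-3-colours = no-detour (Detour.path D) (toℕ-fromℕ< 0<n) (toℕ-fromℕ< 2<n) (Detour.rainbow D) (Detour.avoids-uw D)
    where
    0≢2 : vertex 0<n ≢ vertex 2<n
    0≢2 eq = 0≢1+n (trans (sym (toℕ-fromℕ< 0<n)) (trans (cong toℕ eq) (toℕ-fromℕ< 2<n)))
    D = detour r2c (vertex 0<n) (vertex 2<n) 0≢2
    no-detour : ∀ {u w} (p : Walk G u w) → toℕ u ≡ 0 → toℕ w ≡ 2 → Rainbow p →
                (∀ {x y κ} → ((x , y) , κ) ∈ edges p → ¬ SameEdge (x , y) (toℕ u , toℕ w)) → ⊥
    no-detour [ u ] u≡0 u≡2 _ _ = 0≢1+n (trans (sym u≡0) u≡2)
    no-detour (u ∷⟨ e ⟩ [ w ]) _ _ _ avoids = avoids (here refl) (inj₁ (refl , refl))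
    no-detour (u ∷⟨ e₁ ⟩ (y ∷⟨ e₂ ⟩ [ w ])) u≡0 w≡2 rainbow _ =
      two-step-colours rainbow (subst₂ (λ a b → colour (a , toℕ y) ≡ colour (toℕ y , b)) (sym u≡0) (sym w≡2)
        (middle-colours-agree (toℕ y) (toℕ<n y) (Adj-irrefl (adjacent⇒Adj {u} {y} e₁) ∘ trans u≡0 ∘ sym)
                                                 (Adj-irrefl (adjacent⇒Adj {y} {w} e₂) ∘ (λ y≡2 → trans y≡2 (sym w≡2)))))
    no-detour (u ∷⟨ _ ⟩ (_ ∷⟨ _ ⟩ (_ ∷⟨ _ ⟩ _))) _ _ rainbow _ = no-three-edges rainbow

s₂≥-mono : ∀ {n r m m′} → m′ ≤ m → s₂≥ n r m → s₂≥ n r m′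
s₂≥-mono m′≤m (G , twoConnected , rc , m≤edges) = G , twoConnected , rc , ≤-trans m′≤m m≤edges

rc₂≥-PathClique[t,t] : ∀ {n t} → 2 ≤ t → t < n → rc₂≥ (PathClique.G n t t) (suc t)
rc₂≥-PathClique[t,t] {n} {t} 2≤t t<n k 1+k≤1+t c r2c with 3 ≤? t
... | yes 3≤t = RainbowTwoConnected.needs-1+t-colours ≤-refl 2≤t t<n c r2c refl 3≤t (s≤s⁻¹ 1+k≤1+t)
... | no 3≰t with ≤-antisym (s≤s⁻¹ (≰⇒> 3≰t)) 2≤t
...   | refl = AtMostTwoColours.needs-3-colours t<n c r2c (s≤s⁻¹ 1+k≤1+t)

rc₂≥-PathClique[t,1+t] : ∀ {n t} → 3 ≤ t → suc t < n → n ∸ suc t < t → rc₂≥ (PathClique.G n t (suc t)) (suc (suc t))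
rc₂≥-PathClique[t,1+t] 3≤t 1+t<n small k 1+k≤2+t c r2c =
  RainbowTwoConnected.needs-2+t-colours (n≤1+n _) (≤-trans (n≤1+n 2) 3≤t) 1+t<n c r2c refl 3≤t small (s≤s⁻¹ 1+k≤2+t)

s₂≥-PathClique : ∀ {n t q r} → 2 ≤ t → t ≤ q → q < n → rc₂≥ (PathClique.G n t q) r →
                 s₂≥ n r ((n ∸ 1) + (n ∸ t ∸ 1) C 2 + (n ∸ q))
s₂≥-PathClique {n} {t} {q} 2≤t t≤q q<n rc =
  G , twoConnected 2≤q q<n , rc , edgeCount-lower-bound (≤-trans (n≤1+n 1) 2≤t) 2≤q (≤-trans (s≤s z≤n) q<n)
  where
  open PathClique n t q
  2≤q : 2 ≤ q
  2≤q = ≤-trans 2≤t t≤q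

C2-suc : ∀ s → suc s C 2 ≡ s + s C 2
C2-suc s = trans (sym (nCk+nC[k+1]≡[n+1]C[k+1] s 1)) (cong (_+ s C 2) (nC1≡n s))

k+[t+s]∸t : ∀ k t s → k + (t + s) ∸ t ≡ k + s
k+[t+s]∸t k t s = trans (+-∸-assoc k (m≤m+n t s)) (cong (k +_) (m+n∸m≡n t s))

s₂≥-via-PathClique[t,t] : ∀ t s → 2 ≤ t → s₂≥ (suc t + s) (suc t) ((suc t + s ∸ suc t + 2) C 2 + t)
s₂≥-via-PathClique[t,t] t s 2≤t =
  s₂≥-mono (≤-reflexive count) (s₂≥-PathClique 2≤t ≤-refl t<n (rc₂≥-PathClique[t,t] 2≤t t<n))
  where
  t<n : t < suc t + s
  t<n = s≤s (m≤m+n t s)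
  count : (suc t + s ∸ suc t + 2) C 2 + t ≡ (suc t + s ∸ 1) + (suc t + s ∸ t ∸ 1) C 2 + (suc t + s ∸ t)
  count = begin
    (suc t + s ∸ suc t + 2) C 2 + t ≡⟨ cong (λ x → (x + 2) C 2 + t) (m+n∸m≡n (suc t) s) ⟩
    (s + 2) C 2 + t                  ≡⟨ cong (λ x → x C 2 + t) (+-comm s 2) ⟩
    suc (suc s) C 2 + t              ≡⟨ cong (_+ t) (trans (C2-suc (suc s)) (cong (suc s +_) (C2-suc s))) ⟩
    suc s + (s + s C 2) + t          ≡⟨ solve 3 (λ s t X → (con 1 :+ s) :+ (s :+ X) :+ t := (t :+ s) :+ X :+ (con 1 :+ s)) refl s t (s C 2) ⟩
    t + s + s C 2 + suc s            ≡⟨ cong (λ x → t + s + (x ∸ 1) C 2 + x) (sym (k+[t+s]∸t 1 t s)) ⟩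
    (suc t + s ∸ 1) + (suc t + s ∸ t ∸ 1) C 2 + (suc t + s ∸ t) ∎
    where
    open ≡-Reasoning
    open +-*-Solver

s₂≥-via-PathClique[t,1+t] : ∀ t s → 3 ≤ t → suc s < t → s₂≥ (2 + t + s) (2 + t) ((2 + t + s ∸ (2 + t) + 3) C 2 + (t ∸ 1))
s₂≥-via-PathClique[t,1+t] (suc t) s 3≤1+t 1+s<1+t =
  s₂≥-mono (≤-reflexive count) (s₂≥-PathClique (≤-trans (n≤1+n 2) 3≤1+t) (n≤1+n _) q<n (rc₂≥-PathClique[t,1+t] 3≤1+t q<n small))
  where
  q<n : 2 + t < 3 + t + s
  q<n = s≤s (s≤s (s≤s (m≤m+n t s)))
  small : 3 + t + s ∸ (2 + t) < suc t
  small = subst (_< suc t) (sym (k+[t+s]∸t 1 t s)) 1+s<1+t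
  count : (3 + t + s ∸ (3 + t) + 3) C 2 + t ≡ (3 + t + s ∸ 1) + (3 + t + s ∸ suc t ∸ 1) C 2 + (3 + t + s ∸ (2 + t))
  count = begin
    (3 + t + s ∸ (3 + t) + 3) C 2 + t ≡⟨ cong (λ x → (x + 3) C 2 + t) (m+n∸m≡n (3 + t) s) ⟩
    (s + 3) C 2 + t                    ≡⟨ cong (λ x → x C 2 + t) (+-comm s 3) ⟩
    suc (suc (suc s)) C 2 + t          ≡⟨ cong (_+ t) (trans (C2-suc (suc (suc s))) (cong (suc (suc s) +_) (C2-suc (suc s)))) ⟩
    suc (suc s) + (suc s + suc s C 2) + t
      ≡⟨ solve 3 (λ s t X → (con 2 :+ s) :+ ((con 1 :+ s) :+ X) :+ t := (con 2 :+ t :+ s) :+ X :+ (con 1 :+ s)) refl s t (suc s C 2) ⟩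
    2 + t + s + suc s C 2 + suc s      ≡⟨ cong₂ (λ x y → 2 + t + s + (x ∸ 1) C 2 + y) (sym (k+[t+s]∸t 2 t s)) (sym (k+[t+s]∸t 1 t s)) ⟩
    (3 + t + s ∸ 1) + (3 + t + s ∸ suc t ∸ 1) C 2 + (3 + t + s ∸ (2 + t)) ∎
    where
    open ≡-Reasoning
    open +-*-Solver

proposition4p1-a : ∀ n r → 3 ≤ r → r + 1 ≤ n → s₂≥ n r (((n ∸ r) + 2) C 2 + (r ∸ 1))
proposition4p1-a n (suc t) (s≤s 2≤t) r+1≤n =
  subst (λ n → s₂≥ n (suc t) (((n ∸ suc t) + 2) C 2 + t)) (m+[n∸m]≡n (≤-trans (m≤m+n (suc t) 1) r+1≤n))
        (s₂≥-via-PathClique[t,t] t (n ∸ suc t) 2≤t)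

-- The hypothesis 6 ≤ n is implied by the other two.
proposition4p1-b : ∀ n r → 6 ≤ n → n + 4 ≤ 2 * r → r + 1 ≤ n → s₂≥ n r (((n ∸ r) + 3) C 2 + (r ∸ 3))
proposition4p1-b n r _ n+4≤2r r+1≤n =
  subst (λ n → s₂≥ n r (((n ∸ r) + 3) C 2 + (r ∸ 3))) (m+[n∸m]≡n r≤n) (with-gap r s+4≤r)
  where
  r≤n : r ≤ n
  r≤n = ≤-trans (m≤m+n r 1) r+1≤n
  s = n ∸ r
  1≤s : 1 ≤ s
  1≤s = m<n⇒0<n∸m (subst (_≤ n) (+-comm r 1) r+1≤n)
  s+4≤r : s + 4 ≤ r
  s+4≤r = +-cancelˡ-≤ r (s + 4) r (begin
    r + (s + 4) ≡⟨ sym (+-assoc r s 4) ⟩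
    r + s + 4   ≡⟨ cong (_+ 4) (m+[n∸m]≡n r≤n) ⟩
    n + 4       ≤⟨ n+4≤2r ⟩
    2 * r       ≡⟨ cong (r +_) (+-identityʳ r) ⟩
    r + r       ∎)
    where open ≤-Reasoning
  with-gap : ∀ r → s + 4 ≤ r → s₂≥ (r + s) r (((r + s ∸ r) + 3) C 2 + (r ∸ 3))
  with-gap 0 s+4≤0 = ⊥-elim (<⇒≱ (s≤s z≤n) (≤-trans (m≤n+m 4 s) s+4≤0))
  with-gap 1 s+4≤1 = ⊥-elim (<⇒≱ (s≤s (s≤s z≤n)) (≤-trans (m≤n+m 4 s) s+4≤1))
  with-gap (suc (suc t)) s+4≤2+t = s₂≥-via-PathClique[t,1+t] t s (≤-trans (s≤s (s≤s 1≤s)) 2+s≤t) 2+s≤t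
    where
    2+s≤t : 2 + s ≤ t
    2+s≤t = s≤s⁻¹ (s≤s⁻¹ (subst (_≤ 2 + t) (+-comm s 4) s+4≤2+t))

proposition4p1 : (∀ (n r : ℕ) → 3 ≤ r → r + 1 ≤ n →
    s₂≥ n r (((n ∸ r) + 2) C 2 + (r ∸ 1)))
    ×
    (∀ (n r : ℕ) → 6 ≤ n → n + 4 ≤ 2 * r → r + 1 ≤ n →
    s₂≥ n r (((n ∸ r) + 3) C 2 + (r ∸ 3)))
proposition4p1 = proposition4p1-a , proposition4p1-b
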